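{- Let $\underline R$ be any EEC computation type and let $(\cdot)^\bullet$, $(\cdot)^\circ$ be the generic linear-use CPS self-translation of EEC relative to $\underline R$. Then: (1) If $\Gamma\mid-\vdash t=u:A$, then $\Gamma^\bullet\mid-\vdash t^\bullet=u^\bullet:A^\bullet$. (2) If $\Gamma\mid z{:}\underline A\vdash t=u:\underline B$, then $\Gamma^\bullet\mid k_z{:}\underline B^\circ\vdash t^\circ=u^\circ:\underline A^\circ$.
   Context: **EEC (enriched effect calculus).** There are value-type constants $\alpha,\beta,\ldots$ and a disjoint set of computation-type constants $\underline{\alpha},\underline{\beta},\ldots$. Value types $A,B,C$ and computation types $\underline{A},\underline{B},\underline{C},\underline{D}$ are generated by $A::=\alpha\mid 1\mid A\times B\mid A\to B\mid \underline{A}\mid \underline{A}\multimap\underline{B}$ and $\underline{A}::=\underline{\alpha}\mid\underline{1}\mid\underline{A}\,\&\,\underline{B}\mid A\Rightarrow\underline{B}\mid\underline{I}\mid\ !A\mid\ !A\otimes\underline{B}\mid\underline{0}\mid\underline{A}\oplus\underline{B}$ (every computation type is also a value type; $!A\otimes\underline{B}$ is one primitive binary constructor). Judgements are $\Gamma\mid -\vdash t:A$ and $\Gamma\mid z{:}\underline{A}\vdash t:\underline{B}$, where $\Gamma$ lists distinct variables with value types and the "stoup" holds at most one variable, of computation type; with nonempty stoup the result type is a computation type. Below $\Delta$ is empty or $z{:}\underline{D}$. Typing rules: $\Gamma,x{:}A\mid-\vdash x:A$; $\Gamma\mid-\vdash *:1$; pairs $\langle t,u\rangle:A\times B$, projections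 $\pi_1t,\pi_2t$; $\lambda x{:}A.t:A\to B$ from $\Gamma,x{:}A\mid-\vdash t:B$; application $t\,u$ (all with empty stoup). $\Gamma\mid z{:}\underline A\vdash z:\underline A$; $\Gamma\mid\Delta\vdash\underline{*}:\underline 1$; from $\Gamma\mid\Delta\vdash t:\underline A$, $\Gamma\mid\Delta\vdash u:\underline B$ get $\Gamma\mid\Delta\vdash\langle t,u\rangle_c:\underline A\,\&\,\underline B$, and from $\Gamma\mid\Delta\vdash t:\underline A\,\&\,\underline B$ get $\underline\pi_1t:\underline A$, $\underline\pi_2t:\underline B$; from $\Gamma,x{:}A\mid\Delta\vdash t:\underline B$ get $\Gamma\mid\Delta\vdash\underline\lambda x{:}A.t:A\Rightarrow\underline B$; from $\Gamma\mid\Delta\vdash s:A\Rightarrow\underline B$, $\Gamma\mid-\vdash t:A$ get $\Gamma\mid\Delta\vdash s@t:\underline B$; $\Gamma\mid-\vdash\top:\underline I$; from $\Gamma\mid\Delta\vdash t:\underline I$, $\Gamma\mid-\vdash u:\underline A$ get $\Gamma\mid\Delta\vdash \mathrm{let}\ \top\ \mathrm{be}\ t\ \mathrm{in}\ u:\underline A$; from $\Gamma\mid-\vdash t:A$ get $\Gamma\mid-\vdash\,!t:\,!A$; from $\Gamma\mid\Delta\vdash t:\,!A$, $\Gamma,x{:}A\mid-\vdash u:\underline B$ get $\Gamma\mid\Delta\vdash\mathrm{let}\ !x\ \mathrm{be}\ t\ \mathrm{in}\ u:\underline B$; from $\Gamma\mid-\vdash t:A$, $\Gamma\mid\Delta\vdash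 u:\underline B$ get $\Gamma\mid\Delta\vdash\,!t\otimes u:\,!A\otimes\underline B$; from $\Gamma\mid\Delta\vdash s:\,!A\otimes\underline B$, $\Gamma,x{:}A\mid y{:}\underline B\vdash t:\underline C$ get $\Gamma\mid\Delta\vdash\mathrm{let}\ !x\otimes y\ \mathrm{be}\ s\ \mathrm{in}\ t:\underline C$; from $\Gamma\mid\Delta\vdash t:\underline 0$ get $\Gamma\mid\Delta\vdash\mathrm{abort}_{\underline A}(t):\underline A$; $\mathrm{inl}\,t:\underline A\oplus\underline B$ from $t:\underline A$ and $\mathrm{inr}\,t$ from $t:\underline B$ (same $\Gamma\mid\Delta$); from $\Gamma\mid\Delta\vdash s:\underline A\oplus\underline B$, $\Gamma\mid x{:}\underline A\vdash t:\underline C$, $\Gamma\mid y{:}\underline B\vdash u:\underline C$ get $\Gamma\mid\Delta\vdash\mathrm{case}\ s\ \mathrm{of}\ (\mathrm{inl}\,x\Rightarrow t\mid\mathrm{inr}\,y\Rightarrow u):\underline C$; from $\Gamma\mid z{:}\underline A\vdash t:\underline B$ get $\Gamma\mid-\vdash\hat\lambda z{:}\underline A.t:\underline A\multimap\underline B$; from $\Gamma\mid-\vdash s:\underline A\multimap\underline B$, $\Gamma\mid\Delta\vdash t:\underline A$ get $\Gamma\mid\Delta\vdash s\{t\}:\underline B$. Equality $\Gamma\mid\Delta\vdash t=u:A$ is the least typed congruence (equivalence, compatible with all term formers, containing $\alpha$-equivalence) containing all well-typed instances of: $t=*$ for $t:1$; $\pi_1\langle t,u\rangle=t$, $\pi_2\langle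 t,u\rangle=u$, $\langle\pi_1t,\pi_2t\rangle=t$; $(\lambda x.t)u=t[u/x]$, $\lambda x.(t\,x)=t$ ($x$ not free in $t$); $t=\underline*$ for $t:\underline1$; $\underline\pi_1\langle t,u\rangle_c=t$, $\underline\pi_2\langle t,u\rangle_c=u$, $\langle\underline\pi_1t,\underline\pi_2t\rangle_c=t$; $(\underline\lambda x.t)@u=t[u/x]$, $\underline\lambda x.(t@x)=t$ ($x$ not free); $\mathrm{let}\ \top\ \mathrm{be}\ \top\ \mathrm{in}\ t=t$; $\mathrm{let}\ \top\ \mathrm{be}\ t\ \mathrm{in}\ u[\top/x]=u[t/x]$ for $\Gamma\mid x{:}\underline I\vdash u:\underline A$; $\mathrm{let}\ !x\ \mathrm{be}\ !t\ \mathrm{in}\ u=u[t/x]$; $\mathrm{let}\ !x\ \mathrm{be}\ t\ \mathrm{in}\ u[!x/y]=u[t/y]$ for $\Gamma\mid y{:}\,!A\vdash u:\underline B$; $\mathrm{let}\ !x\otimes y\ \mathrm{be}\ !t\otimes s\ \mathrm{in}\ u=u[t/x,s/y]$; $\mathrm{let}\ !x\otimes y\ \mathrm{be}\ t\ \mathrm{in}\ u[(!x\otimes y)/z]=u[t/z]$ for $\Gamma\mid z{:}\,!A\otimes\underline B\vdash u:\underline C$; $\mathrm{abort}_{\underline A}(t)=u[t/x]$ for $\Gamma\mid x{:}\underline 0\vdash u:\underline A$; $\mathrm{case}\ \mathrm{inl}\,t\ \mathrm{of}\ (\mathrm{inl}\,x\Rightarrow u\mid\mathrm{inr}\,y\Rightarrow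 u')=u[t/x]$ and symmetrically for $\mathrm{inr}$; $\mathrm{case}\ t\ \mathrm{of}\ (\mathrm{inl}\,x\Rightarrow u[\mathrm{inl}\,x/z]\mid\mathrm{inr}\,y\Rightarrow u[\mathrm{inr}\,y/z])=u[t/z]$ for $\Gamma\mid z{:}\underline A\oplus\underline B\vdash u:\underline C$; $(\hat\lambda x.t)\{u\}=t[u/x]$, $\hat\lambda x.(t\{x\})=t$ ($x$ not free). **Generic self-translation relative to a computation type $\underline R$.** Types: $\alpha^\bullet=\alpha$, $1^\bullet=1$, $(A\times B)^\bullet=A^\bullet\times B^\bullet$, $(A\to B)^\bullet=A^\bullet\to B^\bullet$, $\underline A^\bullet=\underline A^\circ\multimap\underline R$ (a computation type viewed as a value type), $(\underline A\multimap\underline B)^\bullet=\underline B^\circ\multimap\underline A^\circ$; $\underline\alpha^\circ=\underline\alpha$ if $\underline\alpha\neq\underline R$ and $\underline\alpha^\circ=\underline I$ if $\underline R$ is the constant $\underline\alpha$; $\underline1^\circ=\underline0$; $(\underline A\,\&\,\underline B)^\circ=\underline A^\circ\oplus\underline B^\circ$; $(A\Rightarrow\underline B)^\circ=\,!(A^\bullet)\otimes\underline B^\circ$; $\underline I^\circ=\underline R$; $(!A)^\circ=A^\bullet\Rightarrow\underline R$; $(!A\otimes\underline B)^\circ=A^\bullet\Rightarrow\underline B^\circ$; $\underline0^\circ=\underline1$; $(\underline A\oplus\underline B)^\circ=\underline A^\circ\,\&\,\underline B^\circ$. For $\Gamma=x_1{:}C_1,\ldots,x_n{:}C_n$, $\Gamma^\bullet=x_1{:}C_1^\bullet,\ldots,x_n{:}C_n^\bullet$.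 To each variable $z$ is associated a distinct fresh variable $k_z$ (so iterating gives $k_{k_z}$); $k,h,k_x,k_y$ below are fresh bound variables. Terms: a judgement $\Gamma\mid-\vdash t:A$ goes to $\Gamma^\bullet\mid-\vdash t^\bullet:A^\bullet$, and $\Gamma\mid z{:}\underline D\vdash t:\underline B$ goes to $\Gamma^\bullet\mid k_z{:}\underline B^\circ\vdash t^\circ:\underline D^\circ$ (contravariantly); type names below refer to the typing rules. Value clauses: $x^\bullet=x$; $*^\bullet=*$; $\langle t,u\rangle^\bullet=\langle t^\bullet,u^\bullet\rangle$; $(\pi_it)^\bullet=\pi_it^\bullet$; $(\lambda x{:}A.t)^\bullet=\lambda x{:}A^\bullet.t^\bullet$; $(t\,u)^\bullet=t^\bullet\,u^\bullet$; $\underline*^\bullet=\hat\lambda k{:}\underline0.\,\mathrm{abort}_{\underline R}(k)$; $\langle t,u\rangle_c^\bullet=\hat\lambda k{:}\underline A^\circ\oplus\underline B^\circ.\,\mathrm{case}\ k\ \mathrm{of}\ (\mathrm{inl}\,k_x\Rightarrow t^\bullet\{k_x\}\mid\mathrm{inr}\,k_y\Rightarrow u^\bullet\{k_y\})$; $(\underline\pi_1t)^\bullet=\hat\lambda k{:}\underline A^\circ.\,t^\bullet\{\mathrm{inl}\,k\}$; $(\underline\pi_2t)^\bullet=\hat\lambda k{:}\underline B^\circ.\,t^\bullet\{\mathrm{inr}\,k\}$; $(\underline\lambda x{:}A.t)^\bullet=\hat\lambda k{:}\,!A^\bullet\otimes\underline B^\circ.\,\mathrm{let}\ !x\otimes h\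 \mathrm{be}\ k\ \mathrm{in}\ t^\bullet\{h\}$; $(s@t)^\bullet=\hat\lambda k{:}\underline B^\circ.\,s^\bullet\{!(t^\bullet)\otimes k\}$; $\top^\bullet=\hat\lambda k{:}\underline R.\,k$; $(\mathrm{let}\ \top\ \mathrm{be}\ t\ \mathrm{in}\ u)^\bullet=\hat\lambda k{:}\underline A^\circ.\,t^\bullet\{u^\bullet\{k\}\}$; $(!t)^\bullet=\hat\lambda k{:}A^\bullet\Rightarrow\underline R.\,k@t^\bullet$; $(\mathrm{let}\ !x\ \mathrm{be}\ t\ \mathrm{in}\ u)^\bullet=\hat\lambda k{:}\underline B^\circ.\,t^\bullet\{\underline\lambda x{:}A^\bullet.\,u^\bullet\{k\}\}$; $(!t\otimes u)^\bullet=\hat\lambda k{:}A^\bullet\Rightarrow\underline B^\circ.\,u^\bullet\{k@t^\bullet\}$; $(\mathrm{let}\ !x\otimes y\ \mathrm{be}\ s\ \mathrm{in}\ t)^\bullet=\hat\lambda k{:}\underline C^\circ.\,s^\bullet\{\underline\lambda x{:}A^\bullet.\,t^\circ[k/k_y]\}$; $(\mathrm{abort}_{\underline A}(t))^\bullet=\hat\lambda k{:}\underline A^\circ.\,t^\bullet\{\underline*\}$; $(\mathrm{inl}\,t)^\bullet=\hat\lambda k{:}\underline A^\circ\,\&\,\underline B^\circ.\,t^\bullet\{\underline\pi_1k\}$; $(\mathrm{inr}\,t)^\bullet=\hat\lambda k{:}\underline A^\circ\,\&\,\underline B^\circ.\,t^\bullet\{\underline\pi_2k\}$; $(\mathrm{case}\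 s\ \mathrm{of}\ (\mathrm{inl}\,x\Rightarrow t\mid\mathrm{inr}\,y\Rightarrow u))^\bullet=\hat\lambda k{:}\underline C^\circ.\,s^\bullet\{\langle t^\circ[k/k_x],u^\circ[k/k_y]\rangle_c\}$; $(\hat\lambda z{:}\underline A.t)^\bullet=\hat\lambda k{:}\underline B^\circ.\,t^\circ[k/k_z]$; $(s\{t\})^\bullet=\hat\lambda k{:}\underline B^\circ.\,t^\bullet\{s^\bullet\{k\}\}$. Computation clauses (stoup $z{:}\underline D$): $z^\circ=k_z$; $\underline*^\circ=\mathrm{abort}_{\underline D^\circ}(k_z)$; $\langle t,u\rangle_c^\circ=\mathrm{case}\ k_z\ \mathrm{of}\ (\mathrm{inl}\,k_x\Rightarrow t^\circ[k_x/k_z]\mid\mathrm{inr}\,k_y\Rightarrow u^\circ[k_y/k_z])$; $(\underline\pi_1t)^\circ=t^\circ[\mathrm{inl}\,k_z/k_z]$; $(\underline\pi_2t)^\circ=t^\circ[\mathrm{inr}\,k_z/k_z]$; $(\underline\lambda x{:}A.t)^\circ=\mathrm{let}\ !x\otimes h\ \mathrm{be}\ k_z\ \mathrm{in}\ t^\circ[h/k_z]$; $(s@t)^\circ=s^\circ[(!(t^\bullet)\otimes k_z)/k_z]$; $(\mathrm{let}\ \top\ \mathrm{be}\ t\ \mathrm{in}\ u)^\circ=t^\circ[u^\bullet\{k_z\}/k_z]$; $(\mathrm{let}\ !x\ \mathrm{be}\ t\ \mathrm{in}\ u)^\circ=t^\circ[(\underline\lambda x{:}A^\bullet.\,u^\bullet\{k_z\})/k_z]$;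 $(!t\otimes u)^\circ=u^\circ[(k_z@t^\bullet)/k_z]$; $(\mathrm{let}\ !x\otimes y\ \mathrm{be}\ s\ \mathrm{in}\ t)^\circ=s^\circ[(\underline\lambda x{:}A^\bullet.\,t^\circ[k_z/k_y])/k_z]$; $(\mathrm{abort}(t))^\circ=t^\circ[\underline*/k_z]$; $(\mathrm{inl}\,t)^\circ=t^\circ[\underline\pi_1k_z/k_z]$; $(\mathrm{inr}\,t)^\circ=t^\circ[\underline\pi_2k_z/k_z]$; $(\mathrm{case}\ s\ \mathrm{of}\ (\mathrm{inl}\,x\Rightarrow t\mid\mathrm{inr}\,y\Rightarrow u))^\circ=s^\circ[\langle t^\circ[k_z/k_x],u^\circ[k_z/k_y]\rangle_c/k_z]$; $(s\{t\})^\circ=t^\circ[s^\bullet\{k_z\}/k_z]$. -}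

module Defs where

open import Data.Nat using (ℕ; _≡ᵇ_)
open import Data.Bool using (if_then_else_)
open import Data.List using (List; []; _∷_)
open import Data.Maybe using (Maybe; just; nothing)

infixr 7 _`×_
infixr 5 _`→_ _⊸_
infixr 7 _&_
infixr 6 _⊕_
infixr 5 _⇛_

-- Types.  Value-type constants `α n and computation-type constants `αc n
-- (disjoint sets, both indexed by ℕ).  ⌈ A ⌉ is a computation type viewed
-- as a value type.

mutual
  data VTy : Set where
    `α   : ℕ → VTy
    𝟙    : VTy
    _`×_ : VTy → VTy → VTy
    _`→_ : VTy → VTy → VTy
    ⌈_⌉  : CTy → VTy
    _⊸_  : CTy → CTy → VTy

  data CTy : Set where
    `αc   : ℕ → CTy
    𝟙c    : CTy
    _&_   : CTy → CTy → CTy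
    _⇛_   : VTy → CTy → CTy
    𝕀     : CTy
    !_    : VTy → CTy
    !_⊗_  : VTy → CTy → CTy      -- the primitive binary constructor !A ⊗ B
    𝟘c    : CTy
    _⊕_   : CTy → CTy → CTy

-- contexts Γ (innermost variable first) and stoups Δ (empty or one
-- computation-type variable)
Ctx : Set
Ctx = List VTy

Stoup : Set
Stoup = Maybe CTy

data _∋_ : Ctx → VTy → Set where
  Z : ∀ {Γ A} → (A ∷ Γ) ∋ A
  S : ∀ {Γ A B} → Γ ∋ A → (B ∷ Γ) ∋ A

-- Terms:  Tm Γ Δ A  is  Γ | Δ ⊢ t : A.  A judgement with nonempty stoup
-- always has a computation result type ⌈ B ⌉ (by construction).

data Tm (Γ : Ctx) : Stoup → VTy → Set where
  var    : ∀ {A} → Γ ∋ A → Tm Γ nothing A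
  unit   : Tm Γ nothing 𝟙
  pair   : ∀ {A B} → Tm Γ nothing A → Tm Γ nothing B → Tm Γ nothing (A `× B)
  fst    : ∀ {A B} → Tm Γ nothing (A `× B) → Tm Γ nothing A
  snd    : ∀ {A B} → Tm Γ nothing (A `× B) → Tm Γ nothing B
  lam    : ∀ {A B} → Tm (A ∷ Γ) nothing B → Tm Γ nothing (A `→ B)
  app    : ∀ {A B} → Tm Γ nothing (A `→ B) → Tm Γ nothing A → Tm Γ nothing B
  svar   : ∀ {A} → Tm Γ (just A) ⌈ A ⌉
  unitc  : ∀ {Δ} → Tm Γ Δ ⌈ 𝟙c ⌉
  pairc  : ∀ {Δ A B} → Tm Γ Δ ⌈ A ⌉ → Tm Γ Δ ⌈ B ⌉ → Tm Γ Δ ⌈ A & B ⌉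
  fstc   : ∀ {Δ A B} → Tm Γ Δ ⌈ A & B ⌉ → Tm Γ Δ ⌈ A ⌉
  sndc   : ∀ {Δ A B} → Tm Γ Δ ⌈ A & B ⌉ → Tm Γ Δ ⌈ B ⌉
  lamc   : ∀ {Δ A B} → Tm (A ∷ Γ) Δ ⌈ B ⌉ → Tm Γ Δ ⌈ A ⇛ B ⌉
  appc   : ∀ {Δ A B} → Tm Γ Δ ⌈ A ⇛ B ⌉ → Tm Γ nothing A → Tm Γ Δ ⌈ B ⌉
  top    : Tm Γ nothing ⌈ 𝕀 ⌉
  letTop : ∀ {Δ A} → Tm Γ Δ ⌈ 𝕀 ⌉ → Tm Γ nothing ⌈ A ⌉ → Tm Γ Δ ⌈ A ⌉
  bang   : ∀ {A} → Tm Γ nothing A → Tm Γ nothing ⌈ ! A ⌉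
  letBang : ∀ {Δ A B} → Tm Γ Δ ⌈ ! A ⌉ → Tm (A ∷ Γ) nothing ⌈ B ⌉ → Tm Γ Δ ⌈ B ⌉
  tensor : ∀ {Δ A B} → Tm Γ nothing A → Tm Γ Δ ⌈ B ⌉ → Tm Γ Δ ⌈ ! A ⊗ B ⌉
  letTensor : ∀ {Δ A B C} → Tm Γ Δ ⌈ ! A ⊗ B ⌉ → Tm (A ∷ Γ) (just B) ⌈ C ⌉ → Tm Γ Δ ⌈ C ⌉
  abort  : ∀ {Δ A} → Tm Γ Δ ⌈ 𝟘c ⌉ → Tm Γ Δ ⌈ A ⌉
  inl    : ∀ {Δ A B} → Tm Γ Δ ⌈ A ⌉ → Tm Γ Δ ⌈ A ⊕ B ⌉
  inr    : ∀ {Δ A B} → Tm Γ Δ ⌈ B ⌉ → Tm Γ Δ ⌈ A ⊕ B ⌉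
  case   : ∀ {Δ A B C} → Tm Γ Δ ⌈ A ⊕ B ⌉ → Tm Γ (just A) ⌈ C ⌉ → Tm Γ (just B) ⌈ C ⌉ → Tm Γ Δ ⌈ C ⌉
  lamh   : ∀ {A B} → Tm Γ (just A) ⌈ B ⌉ → Tm Γ nothing (A ⊸ B)
  apph   : ∀ {Δ A B} → Tm Γ nothing (A ⊸ B) → Tm Γ Δ ⌈ A ⌉ → Tm Γ Δ ⌈ B ⌉

Ren : Ctx → Ctx → Set
Ren Γ Γ' = ∀ {A} → Γ ∋ A → Γ' ∋ A

ext : ∀ {Γ Γ' B} → Ren Γ Γ' → Ren (B ∷ Γ) (B ∷ Γ')
ext ρ Z = Z
ext ρ (S x) = S (ρ x)

rename : ∀ {Γ Γ' Δ A} → Ren Γ Γ' → Tm Γ Δ A → Tm Γ' Δ A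
rename ρ (var x) = var (ρ x)
rename ρ unit = unit
rename ρ (pair t u) = pair (rename ρ t) (rename ρ u)
rename ρ (fst t) = fst (rename ρ t)
rename ρ (snd t) = snd (rename ρ t)
rename ρ (lam t) = lam (rename (ext ρ) t)
rename ρ (app t u) = app (rename ρ t) (rename ρ u)
rename ρ svar = svar
rename ρ unitc = unitc
rename ρ (pairc t u) = pairc (rename ρ t) (rename ρ u)
rename ρ (fstc t) = fstc (rename ρ t)
rename ρ (sndc t) = sndc (rename ρ t)
rename ρ (lamc t) = lamc (rename (ext ρ) t)
rename ρ (appc t u) = appc (rename ρ t) (rename ρ u)
rename ρ top = top
rename ρ (letTop t u) = letTop (rename ρ t) (rename ρ u)
rename ρ (bang t) = bang (rename ρ t)
rename ρ (letBang t u) = letBang (rename ρ t) (rename (ext ρ) u)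
rename ρ (tensor t u) = tensor (rename ρ t) (rename ρ u)
rename ρ (letTensor t u) = letTensor (rename ρ t) (rename (ext ρ) u)
rename ρ (abort t) = abort (rename ρ t)
rename ρ (inl t) = inl (rename ρ t)
rename ρ (inr t) = inr (rename ρ t)
rename ρ (case s t u) = case (rename ρ s) (rename ρ t) (rename ρ u)
rename ρ (lamh t) = lamh (rename ρ t)
rename ρ (apph t u) = apph (rename ρ t) (rename ρ u)

wk : ∀ {Γ Δ A B} → Tm Γ Δ A → Tm (B ∷ Γ) Δ A
wk = rename S

Sub : Ctx → Ctx → Set
Sub Γ Γ' = ∀ {A} → Γ ∋ A → Tm Γ' nothing A

exts : ∀ {Γ Γ' B} → Sub Γ Γ' → Sub (B ∷ Γ) (B ∷ Γ')
exts σ Z = var Z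
exts σ (S x) = wk (σ x)

subst : ∀ {Γ Γ' Δ A} → Sub Γ Γ' → Tm Γ Δ A → Tm Γ' Δ A
subst σ (var x) = σ x
subst σ unit = unit
subst σ (pair t u) = pair (subst σ t) (subst σ u)
subst σ (fst t) = fst (subst σ t)
subst σ (snd t) = snd (subst σ t)
subst σ (lam t) = lam (subst (exts σ) t)
subst σ (app t u) = app (subst σ t) (subst σ u)
subst σ svar = svar
subst σ unitc = unitc
subst σ (pairc t u) = pairc (subst σ t) (subst σ u)
subst σ (fstc t) = fstc (subst σ t)
subst σ (sndc t) = sndc (subst σ t)
subst σ (lamc t) = lamc (subst (exts σ) t)
subst σ (appc t u) = appc (subst σ t) (subst σ u)
subst σ top = top
subst σ (letTop t u) = letTop (subst σ t) (subst σ u)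
subst σ (bang t) = bang (subst σ t)
subst σ (letBang t u) = letBang (subst σ t) (subst (exts σ) u)
subst σ (tensor t u) = tensor (subst σ t) (subst σ u)
subst σ (letTensor t u) = letTensor (subst σ t) (subst (exts σ) u)
subst σ (abort t) = abort (subst σ t)
subst σ (inl t) = inl (subst σ t)
subst σ (inr t) = inr (subst σ t)
subst σ (case s t u) = case (subst σ s) (subst σ t) (subst σ u)
subst σ (lamh t) = lamh (subst σ t)
subst σ (apph t u) = apph (subst σ t) (subst σ u)

_[_] : ∀ {Γ Δ A B} → Tm (B ∷ Γ) Δ A → Tm Γ nothing B → Tm Γ Δ A
_[_] {Γ} {B = B} t u = subst σ t
  where
  σ : Sub (B ∷ Γ) Γ
  σ Z = u
  σ (S x) = var x

-- Substitution for the stoup variable:  sub-stoup u t  is  u[t/z]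
-- for  Γ | z:A ⊢ u : C  and  Γ | Δ ⊢ t : A.
sub-stoup : ∀ {Γ Δ A C} → Tm Γ (just A) C → Tm Γ Δ ⌈ A ⌉ → Tm Γ Δ C
sub-stoup svar s = s
sub-stoup unitc s = unitc
sub-stoup (pairc t u) s = pairc (sub-stoup t s) (sub-stoup u s)
sub-stoup (fstc t) s = fstc (sub-stoup t s)
sub-stoup (sndc t) s = sndc (sub-stoup t s)
sub-stoup (lamc t) s = lamc (sub-stoup t (wk s))
sub-stoup (appc t u) s = appc (sub-stoup t s) u
sub-stoup (letTop t u) s = letTop (sub-stoup t s) u
sub-stoup (letBang t u) s = letBang (sub-stoup t s) u
sub-stoup (tensor t u) s = tensor t (sub-stoup u s)
sub-stoup (letTensor t u) s = letTensor (sub-stoup t s) u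
sub-stoup (abort t) s = abort (sub-stoup t s)
sub-stoup (inl t) s = inl (sub-stoup t s)
sub-stoup (inr t) s = inr (sub-stoup t s)
sub-stoup (case p t u) s = case (sub-stoup p s) t u
sub-stoup (apph t u) s = apph t (sub-stoup u s)

-- Equality judgement  Γ | Δ ⊢ t = u : A : the least typed congruence
-- containing the EEC axioms (α-equivalence is built in via de Bruijn).

infix 4 _≈_

data _≈_ : ∀ {Γ Δ A} → Tm Γ Δ A → Tm Γ Δ A → Set where
  ≈-refl  : ∀ {Γ Δ A} {t : Tm Γ Δ A} → t ≈ t
  ≈-sym   : ∀ {Γ Δ A} {t u : Tm Γ Δ A} → t ≈ u → u ≈ t
  ≈-trans : ∀ {Γ Δ A} {t u v : Tm Γ Δ A} → t ≈ u → u ≈ v → t ≈ v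
  c-pair  : ∀ {Γ A B} {t t' : Tm Γ nothing A} {u u' : Tm Γ nothing B} → t ≈ t' → u ≈ u' → pair t u ≈ pair t' u'
  c-fst   : ∀ {Γ A B} {t t' : Tm Γ nothing (A `× B)} → t ≈ t' → fst t ≈ fst t'
  c-snd   : ∀ {Γ A B} {t t' : Tm Γ nothing (A `× B)} → t ≈ t' → snd t ≈ snd t'
  c-lam   : ∀ {Γ A B} {t t' : Tm (A ∷ Γ) nothing B} → t ≈ t' → lam t ≈ lam t'
  c-app   : ∀ {Γ A B} {t t' : Tm Γ nothing (A `→ B)} {u u' : Tm Γ nothing A} → t ≈ t' → u ≈ u' → app t u ≈ app t' u'
  c-pairc : ∀ {Γ Δ A B} {t t' : Tm Γ Δ ⌈ A ⌉} {u u' : Tm Γ Δ ⌈ B ⌉} → t ≈ t' → u ≈ u' → pairc t u ≈ pairc t' u'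
  c-fstc  : ∀ {Γ Δ A B} {t t' : Tm Γ Δ ⌈ A & B ⌉} → t ≈ t' → fstc t ≈ fstc t'
  c-sndc  : ∀ {Γ Δ A B} {t t' : Tm Γ Δ ⌈ A & B ⌉} → t ≈ t' → sndc t ≈ sndc t'
  c-lamc  : ∀ {Γ Δ A B} {t t' : Tm (A ∷ Γ) Δ ⌈ B ⌉} → t ≈ t' → lamc t ≈ lamc t'
  c-appc  : ∀ {Γ Δ A B} {t t' : Tm Γ Δ ⌈ A ⇛ B ⌉} {u u' : Tm Γ nothing A} → t ≈ t' → u ≈ u' → appc t u ≈ appc t' u'
  c-letTop : ∀ {Γ Δ A} {t t' : Tm Γ Δ ⌈ 𝕀 ⌉} {u u' : Tm Γ nothing ⌈ A ⌉} → t ≈ t' → u ≈ u' → letTop t u ≈ letTop t' u'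
  c-bang  : ∀ {Γ A} {t t' : Tm Γ nothing A} → t ≈ t' → bang t ≈ bang t'
  c-letBang : ∀ {Γ Δ A B} {t t' : Tm Γ Δ ⌈ ! A ⌉} {u u' : Tm (A ∷ Γ) nothing ⌈ B ⌉} → t ≈ t' → u ≈ u' → letBang t u ≈ letBang t' u'
  c-tensor : ∀ {Γ Δ A B} {t t' : Tm Γ nothing A} {u u' : Tm Γ Δ ⌈ B ⌉} → t ≈ t' → u ≈ u' → tensor t u ≈ tensor t' u'
  c-letTensor : ∀ {Γ Δ A B C} {s s' : Tm Γ Δ ⌈ ! A ⊗ B ⌉} {t t' : Tm (A ∷ Γ) (just B) ⌈ C ⌉} → s ≈ s' → t ≈ t' → letTensor s t ≈ letTensor s' t'
  c-abort : ∀ {Γ Δ A} {t t' : Tm Γ Δ ⌈ 𝟘c ⌉} → t ≈ t' → abort {A = A} t ≈ abort t'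
  c-inl   : ∀ {Γ Δ A B} {t t' : Tm Γ Δ ⌈ A ⌉} → t ≈ t' → inl {B = B} t ≈ inl t'
  c-inr   : ∀ {Γ Δ A B} {t t' : Tm Γ Δ ⌈ B ⌉} → t ≈ t' → inr {A = A} t ≈ inr t'
  c-case  : ∀ {Γ Δ A B C} {s s' : Tm Γ Δ ⌈ A ⊕ B ⌉} {t t' : Tm Γ (just A) ⌈ C ⌉} {u u' : Tm Γ (just B) ⌈ C ⌉} → s ≈ s' → t ≈ t' → u ≈ u' → case s t u ≈ case s' t' u'
  c-lamh  : ∀ {Γ A B} {t t' : Tm Γ (just A) ⌈ B ⌉} → t ≈ t' → lamh t ≈ lamh t'
  c-apph  : ∀ {Γ Δ A B} {s s' : Tm Γ nothing (A ⊸ B)} {t t' : Tm Γ Δ ⌈ A ⌉} → s ≈ s' → t ≈ t' → apph s t ≈ apph s' t'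
  η-𝟙  : ∀ {Γ} (t : Tm Γ nothing 𝟙) → t ≈ unit
  β-×₁ : ∀ {Γ A B} (t : Tm Γ nothing A) (u : Tm Γ nothing B) → fst (pair t u) ≈ t
  β-×₂ : ∀ {Γ A B} (t : Tm Γ nothing A) (u : Tm Γ nothing B) → snd (pair t u) ≈ u
  η-×  : ∀ {Γ A B} (t : Tm Γ nothing (A `× B)) → pair (fst t) (snd t) ≈ t
  β-→  : ∀ {Γ A B} (t : Tm (A ∷ Γ) nothing B) (u : Tm Γ nothing A) → app (lam t) u ≈ t [ u ]
  η-→  : ∀ {Γ A B} (t : Tm Γ nothing (A `→ B)) → lam (app (wk t) (var Z)) ≈ t
  η-𝟙c : ∀ {Γ Δ} (t : Tm Γ Δ ⌈ 𝟙c ⌉) → t ≈ unitc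
  β-&₁ : ∀ {Γ Δ A B} (t : Tm Γ Δ ⌈ A ⌉) (u : Tm Γ Δ ⌈ B ⌉) → fstc (pairc t u) ≈ t
  β-&₂ : ∀ {Γ Δ A B} (t : Tm Γ Δ ⌈ A ⌉) (u : Tm Γ Δ ⌈ B ⌉) → sndc (pairc t u) ≈ u
  η-&  : ∀ {Γ Δ A B} (t : Tm Γ Δ ⌈ A & B ⌉) → pairc (fstc t) (sndc t) ≈ t
  β-⇛  : ∀ {Γ Δ A B} (t : Tm (A ∷ Γ) Δ ⌈ B ⌉) (u : Tm Γ nothing A) → appc (lamc t) u ≈ t [ u ]
  η-⇛  : ∀ {Γ Δ A B} (t : Tm Γ Δ ⌈ A ⇛ B ⌉) → lamc (appc (wk t) (var Z)) ≈ t
  β-𝕀  : ∀ {Γ A} (t : Tm Γ nothing ⌈ A ⌉) → letTop top t ≈ t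
  η-𝕀  : ∀ {Γ Δ A} (t : Tm Γ Δ ⌈ 𝕀 ⌉) (u : Tm Γ (just 𝕀) ⌈ A ⌉) → letTop t (sub-stoup u top) ≈ sub-stoup u t
  β-!  : ∀ {Γ A B} (t : Tm Γ nothing A) (u : Tm (A ∷ Γ) nothing ⌈ B ⌉) → letBang (bang t) u ≈ u [ t ]
  η-!  : ∀ {Γ Δ A B} (t : Tm Γ Δ ⌈ ! A ⌉) (u : Tm Γ (just (! A)) ⌈ B ⌉) → letBang t (sub-stoup (wk u) (bang (var Z))) ≈ sub-stoup u t
  β-⊗  : ∀ {Γ Δ A B C} (t : Tm Γ nothing A) (s : Tm Γ Δ ⌈ B ⌉) (u : Tm (A ∷ Γ) (just B) ⌈ C ⌉) → letTensor (tensor t s) u ≈ sub-stoup (u [ t ]) s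
  η-⊗  : ∀ {Γ Δ A B C} (t : Tm Γ Δ ⌈ ! A ⊗ B ⌉) (u : Tm Γ (just (! A ⊗ B)) ⌈ C ⌉) → letTensor t (sub-stoup (wk u) (tensor (var Z) svar)) ≈ sub-stoup u t
  η-𝟘  : ∀ {Γ Δ A} (t : Tm Γ Δ ⌈ 𝟘c ⌉) (u : Tm Γ (just 𝟘c) ⌈ A ⌉) → abort t ≈ sub-stoup u t
  β-⊕₁ : ∀ {Γ Δ A B C} (t : Tm Γ Δ ⌈ A ⌉) (u : Tm Γ (just A) ⌈ C ⌉) (u' : Tm Γ (just B) ⌈ C ⌉) → case (inl t) u u' ≈ sub-stoup u t
  β-⊕₂ : ∀ {Γ Δ A B C} (t : Tm Γ Δ ⌈ B ⌉) (u : Tm Γ (just A) ⌈ C ⌉) (u' : Tm Γ (just B) ⌈ C ⌉) → case (inr t) u u' ≈ sub-stoup u' t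
  η-⊕  : ∀ {Γ Δ A B C} (t : Tm Γ Δ ⌈ A ⊕ B ⌉) (u : Tm Γ (just (A ⊕ B)) ⌈ C ⌉) → case t (sub-stoup u (inl svar)) (sub-stoup u (inr svar)) ≈ sub-stoup u t
  β-⊸  : ∀ {Γ Δ A B} (t : Tm Γ (just A) ⌈ B ⌉) (u : Tm Γ Δ ⌈ A ⌉) → apph (lamh t) u ≈ sub-stoup t u
  η-⊸  : ∀ {Γ A B} (t : Tm Γ nothing (A ⊸ B)) → lamh (apph t svar) ≈ t

constC : CTy → ℕ → CTy
constC (`αc m) n = if m ≡ᵇ n then 𝕀 else `αc n
constC _ n = `αc n

module Translation (R : CTy) where

  mutual
    vty : VTy → VTy
    vty (`α n) = `α n
    vty 𝟙 = 𝟙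
    vty (A `× B) = vty A `× vty B
    vty (A `→ B) = vty A `→ vty B
    vty ⌈ A ⌉ = cty A ⊸ R
    vty (A ⊸ B) = cty B ⊸ cty A

    cty : CTy → CTy
    cty (`αc n) = constC R n
    cty 𝟙c = 𝟘c
    cty (A & B) = cty A ⊕ cty B
    cty (A ⇛ B) = ! vty A ⊗ cty B
    cty 𝕀 = R
    cty (! A) = vty A ⇛ R
    cty (! A ⊗ B) = vty A ⇛ cty B
    cty 𝟘c = 𝟙c
    cty (A ⊕ B) = cty A & cty B

  ctx : Ctx → Ctx
  ctx [] = []
  ctx (A ∷ Γ) = vty A ∷ ctx Γ

  tvar : ∀ {Γ A} → Γ ∋ A → ctx Γ ∋ vty A
  tvar Z = Z
  tvar (S x) = S (tvar x)

  mutual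
    val : ∀ {Γ A} → Tm Γ nothing A → Tm (ctx Γ) nothing (vty A)
    val (var x) = var (tvar x)
    val unit = unit
    val (pair t u) = pair (val t) (val u)
    val (fst t) = fst (val t)
    val (snd t) = snd (val t)
    val (lam t) = lam (val t)
    val (app t u) = app (val t) (val u)
    val unitc = lamh (abort svar)
    val (pairc t u) = lamh (case svar (apph (val t) svar) (apph (val u) svar))
    val (fstc t) = lamh (apph (val t) (inl svar))
    val (sndc t) = lamh (apph (val t) (inr svar))
    val (lamc t) = lamh (letTensor svar (apph (val t) svar))
    val (appc s t) = lamh (apph (val s) (tensor (val t) svar))
    val top = lamh svar
    val (letTop t u) = lamh (apph (val t) (apph (val u) svar))
    val (bang t) = lamh (appc svar (val t))
    val (letBang t u) = lamh (apph (val t) (lamc (apph (val u) svar)))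
    val (tensor t u) = lamh (apph (val u) (appc svar (val t)))
    val (letTensor s t) = lamh (apph (val s) (lamc (comp t)))
    val (abort t) = lamh (apph (val t) unitc)
    val (inl t) = lamh (apph (val t) (fstc svar))
    val (inr t) = lamh (apph (val t) (sndc svar))
    val (case s t u) = lamh (apph (val s) (pairc (comp t) (comp u)))
    val (lamh t) = lamh (comp t)
    val (apph s t) = lamh (apph (val t) (apph (val s) svar))

    comp : ∀ {Γ D B} → Tm Γ (just D) ⌈ B ⌉ → Tm (ctx Γ) (just (cty B)) ⌈ cty D ⌉
    comp svar = svar
    comp unitc = abort svar
    comp (pairc t u) = case svar (comp t) (comp u)
    comp (fstc t) = sub-stoup (comp t) (inl svar)
    comp (sndc t) = sub-stoup (comp t) (inr svar)
    comp (lamc t) = letTensor svar (comp t)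
    comp (appc s t) = sub-stoup (comp s) (tensor (val t) svar)
    comp (letTop t u) = sub-stoup (comp t) (apph (val u) svar)
    comp (letBang t u) = sub-stoup (comp t) (lamc (apph (val u) svar))
    comp (tensor t u) = sub-stoup (comp u) (appc svar (val t))
    comp (letTensor s t) = sub-stoup (comp s) (lamc (comp t))
    comp (abort t) = sub-stoup (comp t) unitc
    comp (inl t) = sub-stoup (comp t) (fstc svar)
    comp (inr t) = sub-stoup (comp t) (sndc svar)
    comp (case s t u) = sub-stoup (comp s) (pairc (comp t) (comp u))
    comp (apph s t) = sub-stoup (comp t) (apph (val s) svar)

module Submission where

-- The proof is an induction on the derivation of t ≈ u; congruence rules
-- go to congruence rules, and a β- or η-axiom of a connective goes to the
-- β- or η-axiom of its dual.  What makes the axioms go through is that the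
-- translation commutes with substitution: syntactically for context
-- variables ((t [ u ])• ≡ t• [ u• ]) and, up to ≈ and with the order
-- reversed, for the stoup variable ((u[t/z])∘ ≈ t∘[u∘/k]).

open import Defs
open import Data.List using (_∷_)
open import Data.Maybe using (just; nothing)
open import Data.Product using (_×_; _,_)
open import Relation.Binary.Bundles using (Setoid)
open import Relation.Binary.PropositionalEquality using (_≡_; refl; sym; trans; cong; cong₂; module ≡-Reasoning)
import Relation.Binary.Reasoning.Setoid as SetoidReasoning

cong₃ : ∀ {A B C D : Set} (f : A → B → C → D) {x y u v w z} →
        x ≡ y → u ≡ v → w ≡ z → f x u w ≡ f y v z
cong₃ f refl refl refl = refl

-- Renaming and
-- substitution only depend on the pointwise values of the map; there is no
-- function extensionality, so this is stated explicitly.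
_≗ᴿ_ : ∀ {Γ Γ'} → Ren Γ Γ' → Ren Γ Γ' → Set
ρ ≗ᴿ ρ' = ∀ {A} (x : _ ∋ A) → ρ x ≡ ρ' x

_≗ˢ_ : ∀ {Γ Γ'} → Sub Γ Γ' → Sub Γ Γ' → Set
σ ≗ˢ σ' = ∀ {A} (x : _ ∋ A) → σ x ≡ σ' x

ext-cong : ∀ {Γ Γ' B} {ρ ρ' : Ren Γ Γ'} → ρ ≗ᴿ ρ' → ext {B = B} ρ ≗ᴿ ext ρ'
ext-cong h Z = refl
ext-cong h (S x) = cong S (h x)

rename-cong : ∀ {Γ Γ' Δ A} {ρ ρ' : Ren Γ Γ'} → ρ ≗ᴿ ρ' →
              (t : Tm Γ Δ A) → rename ρ t ≡ rename ρ' t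
rename-cong h (var x) = cong var (h x)
rename-cong h unit = refl
rename-cong h (pair t u) = cong₂ pair (rename-cong h t) (rename-cong h u)
rename-cong h (fst t) = cong fst (rename-cong h t)
rename-cong h (snd t) = cong snd (rename-cong h t)
rename-cong h (lam t) = cong lam (rename-cong (ext-cong h) t)
rename-cong h (app t u) = cong₂ app (rename-cong h t) (rename-cong h u)
rename-cong h svar = refl
rename-cong h unitc = refl
rename-cong h (pairc t u) = cong₂ pairc (rename-cong h t) (rename-cong h u)
rename-cong h (fstc t) = cong fstc (rename-cong h t)
rename-cong h (sndc t) = cong sndc (rename-cong h t)
rename-cong h (lamc t) = cong lamc (rename-cong (ext-cong h) t)
rename-cong h (appc t u) = cong₂ appc (rename-cong h t) (rename-cong h u)
rename-cong h top = refl
rename-cong h (letTop t u) = cong₂ letTop (rename-cong h t) (rename-cong h u)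
rename-cong h (bang t) = cong bang (rename-cong h t)
rename-cong h (letBang t u) = cong₂ letBang (rename-cong h t) (rename-cong (ext-cong h) u)
rename-cong h (tensor t u) = cong₂ tensor (rename-cong h t) (rename-cong h u)
rename-cong h (letTensor t u) = cong₂ letTensor (rename-cong h t) (rename-cong (ext-cong h) u)
rename-cong h (abort t) = cong abort (rename-cong h t)
rename-cong h (inl t) = cong inl (rename-cong h t)
rename-cong h (inr t) = cong inr (rename-cong h t)
rename-cong h (case s t u) = cong₃ case (rename-cong h s) (rename-cong h t) (rename-cong h u)
rename-cong h (lamh t) = cong lamh (rename-cong h t)
rename-cong h (apph t u) = cong₂ apph (rename-cong h t) (rename-cong h u)

exts-cong : ∀ {Γ Γ' B} {σ σ' : Sub Γ Γ'} → σ ≗ˢ σ' → exts {B = B} σ ≗ˢ exts σ'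
exts-cong h Z = refl
exts-cong h (S x) = cong wk (h x)

subst-cong : ∀ {Γ Γ' Δ A} {σ σ' : Sub Γ Γ'} → σ ≗ˢ σ' →
             (t : Tm Γ Δ A) → subst σ t ≡ subst σ' t
subst-cong h (var x) = h x
subst-cong h unit = refl
subst-cong h (pair t u) = cong₂ pair (subst-cong h t) (subst-cong h u)
subst-cong h (fst t) = cong fst (subst-cong h t)
subst-cong h (snd t) = cong snd (subst-cong h t)
subst-cong h (lam t) = cong lam (subst-cong (exts-cong h) t)
subst-cong h (app t u) = cong₂ app (subst-cong h t) (subst-cong h u)
subst-cong h svar = refl
subst-cong h unitc = refl
subst-cong h (pairc t u) = cong₂ pairc (subst-cong h t) (subst-cong h u)
subst-cong h (fstc t) = cong fstc (subst-cong h t)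
subst-cong h (sndc t) = cong sndc (subst-cong h t)
subst-cong h (lamc t) = cong lamc (subst-cong (exts-cong h) t)
subst-cong h (appc t u) = cong₂ appc (subst-cong h t) (subst-cong h u)
subst-cong h top = refl
subst-cong h (letTop t u) = cong₂ letTop (subst-cong h t) (subst-cong h u)
subst-cong h (bang t) = cong bang (subst-cong h t)
subst-cong h (letBang t u) = cong₂ letBang (subst-cong h t) (subst-cong (exts-cong h) u)
subst-cong h (tensor t u) = cong₂ tensor (subst-cong h t) (subst-cong h u)
subst-cong h (letTensor t u) = cong₂ letTensor (subst-cong h t) (subst-cong (exts-cong h) u)
subst-cong h (abort t) = cong abort (subst-cong h t)
subst-cong h (inl t) = cong inl (subst-cong h t)
subst-cong h (inr t) = cong inr (subst-cong h t)
subst-cong h (case s t u) = cong₃ case (subst-cong h s) (subst-cong h t) (subst-cong h u)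
subst-cong h (lamh t) = cong lamh (subst-cong h t)
subst-cong h (apph t u) = cong₂ apph (subst-cong h t) (subst-cong h u)

ext-fusion : ∀ {Γ₁ Γ₂ Γ₃ B} {ρ : Ren Γ₂ Γ₃} {ρ' : Ren Γ₁ Γ₂} →
             (λ {A} (x : (B ∷ Γ₁) ∋ A) → ext ρ (ext ρ' x)) ≗ᴿ ext (λ x → ρ (ρ' x))
ext-fusion Z = refl
ext-fusion (S x) = refl

rename-rename : ∀ {Γ₁ Γ₂ Γ₃ Δ A} (ρ : Ren Γ₂ Γ₃) (ρ' : Ren Γ₁ Γ₂) (t : Tm Γ₁ Δ A) →
                rename ρ (rename ρ' t) ≡ rename (λ x → ρ (ρ' x)) t
rename-rename ρ ρ' (var x) = refl
rename-rename ρ ρ' unit = refl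
rename-rename ρ ρ' (pair t u) = cong₂ pair (rename-rename ρ ρ' t) (rename-rename ρ ρ' u)
rename-rename ρ ρ' (fst t) = cong fst (rename-rename ρ ρ' t)
rename-rename ρ ρ' (snd t) = cong snd (rename-rename ρ ρ' t)
rename-rename ρ ρ' (lam t) = cong lam (trans (rename-rename (ext ρ) (ext ρ') t) (rename-cong ext-fusion t))
rename-rename ρ ρ' (app t u) = cong₂ app (rename-rename ρ ρ' t) (rename-rename ρ ρ' u)
rename-rename ρ ρ' svar = refl
rename-rename ρ ρ' unitc = refl
rename-rename ρ ρ' (pairc t u) = cong₂ pairc (rename-rename ρ ρ' t) (rename-rename ρ ρ' u)
rename-rename ρ ρ' (fstc t) = cong fstc (rename-rename ρ ρ' t)
rename-rename ρ ρ' (sndc t) = cong sndc (rename-rename ρ ρ' t)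
rename-rename ρ ρ' (lamc t) = cong lamc (trans (rename-rename (ext ρ) (ext ρ') t) (rename-cong ext-fusion t))
rename-rename ρ ρ' (appc t u) = cong₂ appc (rename-rename ρ ρ' t) (rename-rename ρ ρ' u)
rename-rename ρ ρ' top = refl
rename-rename ρ ρ' (letTop t u) = cong₂ letTop (rename-rename ρ ρ' t) (rename-rename ρ ρ' u)
rename-rename ρ ρ' (bang t) = cong bang (rename-rename ρ ρ' t)
rename-rename ρ ρ' (letBang t u) = cong₂ letBang (rename-rename ρ ρ' t) (trans (rename-rename (ext ρ) (ext ρ') u) (rename-cong ext-fusion u))
rename-rename ρ ρ' (tensor t u) = cong₂ tensor (rename-rename ρ ρ' t) (rename-rename ρ ρ' u)
rename-rename ρ ρ' (letTensor t u) = cong₂ letTensor (rename-rename ρ ρ' t) (trans (rename-rename (ext ρ) (ext ρ') u) (rename-cong ext-fusion u))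
rename-rename ρ ρ' (abort t) = cong abort (rename-rename ρ ρ' t)
rename-rename ρ ρ' (inl t) = cong inl (rename-rename ρ ρ' t)
rename-rename ρ ρ' (inr t) = cong inr (rename-rename ρ ρ' t)
rename-rename ρ ρ' (case s t u) = cong₃ case (rename-rename ρ ρ' s) (rename-rename ρ ρ' t) (rename-rename ρ ρ' u)
rename-rename ρ ρ' (lamh t) = cong lamh (rename-rename ρ ρ' t)
rename-rename ρ ρ' (apph t u) = cong₂ apph (rename-rename ρ ρ' t) (rename-rename ρ ρ' u)

exts-ext-fusion : ∀ {Γ₁ Γ₂ Γ₃ B} {σ : Sub Γ₂ Γ₃} {ρ : Ren Γ₁ Γ₂} →
                  (λ {A} (x : (B ∷ Γ₁) ∋ A) → exts σ (ext ρ x)) ≗ˢ exts (λ x → σ (ρ x))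
exts-ext-fusion Z = refl
exts-ext-fusion (S x) = refl

subst-rename : ∀ {Γ₁ Γ₂ Γ₃ Δ A} (σ : Sub Γ₂ Γ₃) (ρ : Ren Γ₁ Γ₂) (t : Tm Γ₁ Δ A) →
               subst σ (rename ρ t) ≡ subst (λ x → σ (ρ x)) t
subst-rename σ ρ (var x) = refl
subst-rename σ ρ unit = refl
subst-rename σ ρ (pair t u) = cong₂ pair (subst-rename σ ρ t) (subst-rename σ ρ u)
subst-rename σ ρ (fst t) = cong fst (subst-rename σ ρ t)
subst-rename σ ρ (snd t) = cong snd (subst-rename σ ρ t)
subst-rename σ ρ (lam t) = cong lam (trans (subst-rename (exts σ) (ext ρ) t) (subst-cong exts-ext-fusion t))
subst-rename σ ρ (app t u) = cong₂ app (subst-rename σ ρ t) (subst-rename σ ρ u)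
subst-rename σ ρ svar = refl
subst-rename σ ρ unitc = refl
subst-rename σ ρ (pairc t u) = cong₂ pairc (subst-rename σ ρ t) (subst-rename σ ρ u)
subst-rename σ ρ (fstc t) = cong fstc (subst-rename σ ρ t)
subst-rename σ ρ (sndc t) = cong sndc (subst-rename σ ρ t)
subst-rename σ ρ (lamc t) = cong lamc (trans (subst-rename (exts σ) (ext ρ) t) (subst-cong exts-ext-fusion t))
subst-rename σ ρ (appc t u) = cong₂ appc (subst-rename σ ρ t) (subst-rename σ ρ u)
subst-rename σ ρ top = refl
subst-rename σ ρ (letTop t u) = cong₂ letTop (subst-rename σ ρ t) (subst-rename σ ρ u)
subst-rename σ ρ (bang t) = cong bang (subst-rename σ ρ t)
subst-rename σ ρ (letBang t u) = cong₂ letBang (subst-rename σ ρ t) (trans (subst-rename (exts σ) (ext ρ) u) (subst-cong exts-ext-fusion u))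
subst-rename σ ρ (tensor t u) = cong₂ tensor (subst-rename σ ρ t) (subst-rename σ ρ u)
subst-rename σ ρ (letTensor t u) = cong₂ letTensor (subst-rename σ ρ t) (trans (subst-rename (exts σ) (ext ρ) u) (subst-cong exts-ext-fusion u))
subst-rename σ ρ (abort t) = cong abort (subst-rename σ ρ t)
subst-rename σ ρ (inl t) = cong inl (subst-rename σ ρ t)
subst-rename σ ρ (inr t) = cong inr (subst-rename σ ρ t)
subst-rename σ ρ (case s t u) = cong₃ case (subst-rename σ ρ s) (subst-rename σ ρ t) (subst-rename σ ρ u)
subst-rename σ ρ (lamh t) = cong lamh (subst-rename σ ρ t)
subst-rename σ ρ (apph t u) = cong₂ apph (subst-rename σ ρ t) (subst-rename σ ρ u)

rename-ext-wk : ∀ {Γ Γ' Δ A B} (ρ : Ren Γ Γ') (t : Tm Γ Δ A) →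
                rename (ext {B = B} ρ) (wk t) ≡ wk (rename ρ t)
rename-ext-wk ρ t = trans (rename-rename (ext ρ) S t) (sym (rename-rename S ρ t))

ext-exts-fusion : ∀ {Γ₁ Γ₂ Γ₃ B} (ρ : Ren Γ₂ Γ₃) (σ : Sub Γ₁ Γ₂) →
                  (λ {A} (x : (B ∷ Γ₁) ∋ A) → rename (ext ρ) (exts σ x)) ≗ˢ exts (λ x → rename ρ (σ x))
ext-exts-fusion ρ σ Z = refl
ext-exts-fusion ρ σ (S x) = rename-ext-wk ρ (σ x)

rename-subst : ∀ {Γ₁ Γ₂ Γ₃ Δ A} (ρ : Ren Γ₂ Γ₃) (σ : Sub Γ₁ Γ₂) (t : Tm Γ₁ Δ A) →
               rename ρ (subst σ t) ≡ subst (λ x → rename ρ (σ x)) t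
rename-subst ρ σ (var x) = refl
rename-subst ρ σ unit = refl
rename-subst ρ σ (pair t u) = cong₂ pair (rename-subst ρ σ t) (rename-subst ρ σ u)
rename-subst ρ σ (fst t) = cong fst (rename-subst ρ σ t)
rename-subst ρ σ (snd t) = cong snd (rename-subst ρ σ t)
rename-subst ρ σ (lam t) = cong lam (trans (rename-subst (ext ρ) (exts σ) t) (subst-cong (ext-exts-fusion ρ σ) t))
rename-subst ρ σ (app t u) = cong₂ app (rename-subst ρ σ t) (rename-subst ρ σ u)
rename-subst ρ σ svar = refl
rename-subst ρ σ unitc = refl
rename-subst ρ σ (pairc t u) = cong₂ pairc (rename-subst ρ σ t) (rename-subst ρ σ u)
rename-subst ρ σ (fstc t) = cong fstc (rename-subst ρ σ t)
rename-subst ρ σ (sndc t) = cong sndc (rename-subst ρ σ t)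
rename-subst ρ σ (lamc t) = cong lamc (trans (rename-subst (ext ρ) (exts σ) t) (subst-cong (ext-exts-fusion ρ σ) t))
rename-subst ρ σ (appc t u) = cong₂ appc (rename-subst ρ σ t) (rename-subst ρ σ u)
rename-subst ρ σ top = refl
rename-subst ρ σ (letTop t u) = cong₂ letTop (rename-subst ρ σ t) (rename-subst ρ σ u)
rename-subst ρ σ (bang t) = cong bang (rename-subst ρ σ t)
rename-subst ρ σ (letBang t u) = cong₂ letBang (rename-subst ρ σ t) (trans (rename-subst (ext ρ) (exts σ) u) (subst-cong (ext-exts-fusion ρ σ) u))
rename-subst ρ σ (tensor t u) = cong₂ tensor (rename-subst ρ σ t) (rename-subst ρ σ u)
rename-subst ρ σ (letTensor t u) = cong₂ letTensor (rename-subst ρ σ t) (trans (rename-subst (ext ρ) (exts σ) u) (subst-cong (ext-exts-fusion ρ σ) u))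
rename-subst ρ σ (abort t) = cong abort (rename-subst ρ σ t)
rename-subst ρ σ (inl t) = cong inl (rename-subst ρ σ t)
rename-subst ρ σ (inr t) = cong inr (rename-subst ρ σ t)
rename-subst ρ σ (case s t u) = cong₃ case (rename-subst ρ σ s) (rename-subst ρ σ t) (rename-subst ρ σ u)
rename-subst ρ σ (lamh t) = cong lamh (rename-subst ρ σ t)
rename-subst ρ σ (apph t u) = cong₂ apph (rename-subst ρ σ t) (rename-subst ρ σ u)

subst-exts-wk : ∀ {Γ Γ' Δ A B} (σ : Sub Γ Γ') (t : Tm Γ Δ A) →
                subst (exts {B = B} σ) (wk t) ≡ wk (subst σ t)
subst-exts-wk σ t = trans (subst-rename (exts σ) S t) (sym (rename-subst S σ t))

exts-var : ∀ {Γ B} → exts {B = B} (λ {A} (y : Γ ∋ A) → var y) ≗ˢ var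
exts-var Z = refl
exts-var (S x) = refl

subst-var-id : ∀ {Γ Δ A} (t : Tm Γ Δ A) → subst (λ x → var x) t ≡ t
subst-var-id (var x) = refl
subst-var-id unit = refl
subst-var-id (pair t u) = cong₂ pair (subst-var-id t) (subst-var-id u)
subst-var-id (fst t) = cong fst (subst-var-id t)
subst-var-id (snd t) = cong snd (subst-var-id t)
subst-var-id (lam t) = cong lam (trans (subst-cong exts-var t) (subst-var-id t))
subst-var-id (app t u) = cong₂ app (subst-var-id t) (subst-var-id u)
subst-var-id svar = refl
subst-var-id unitc = refl
subst-var-id (pairc t u) = cong₂ pairc (subst-var-id t) (subst-var-id u)
subst-var-id (fstc t) = cong fstc (subst-var-id t)
subst-var-id (sndc t) = cong sndc (subst-var-id t)
subst-var-id (lamc t) = cong lamc (trans (subst-cong exts-var t) (subst-var-id t))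
subst-var-id (appc t u) = cong₂ appc (subst-var-id t) (subst-var-id u)
subst-var-id top = refl
subst-var-id (letTop t u) = cong₂ letTop (subst-var-id t) (subst-var-id u)
subst-var-id (bang t) = cong bang (subst-var-id t)
subst-var-id (letBang t u) = cong₂ letBang (subst-var-id t) (trans (subst-cong exts-var u) (subst-var-id u))
subst-var-id (tensor t u) = cong₂ tensor (subst-var-id t) (subst-var-id u)
subst-var-id (letTensor t u) = cong₂ letTensor (subst-var-id t) (trans (subst-cong exts-var u) (subst-var-id u))
subst-var-id (abort t) = cong abort (subst-var-id t)
subst-var-id (inl t) = cong inl (subst-var-id t)
subst-var-id (inr t) = cong inr (subst-var-id t)
subst-var-id (case s t u) = cong₃ case (subst-var-id s) (subst-var-id t) (subst-var-id u)
subst-var-id (lamh t) = cong lamh (subst-var-id t)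
subst-var-id (apph t u) = cong₂ apph (subst-var-id t) (subst-var-id u)

-- Substitution of a single term for the innermost variable, as an explicit
-- substitution (the one in Defs is local to the definition of _[_]).
single : ∀ {Γ B} → Tm Γ nothing B → Sub (B ∷ Γ) Γ
single u Z = u
single u (S x) = var x

[]-single : ∀ {Γ Δ A B} (t : Tm (B ∷ Γ) Δ A) (u : Tm Γ nothing B) →
            t [ u ] ≡ subst (single u) t
[]-single t u = subst-cong (λ { Z → refl ; (S x) → refl }) t

rename-[] : ∀ {Γ Γ' Δ A B} (ρ : Ren Γ Γ') (t : Tm (B ∷ Γ) Δ A) (u : Tm Γ nothing B) →
            rename ρ (t [ u ]) ≡ rename (ext ρ) t [ rename ρ u ]
rename-[] ρ t u = begin
  rename ρ (t [ u ])                                 ≡⟨ cong (rename ρ) ([]-single t u) ⟩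
  rename ρ (subst (single u) t)                      ≡⟨ rename-subst ρ (single u) t ⟩
  subst (λ x → rename ρ (single u x)) t              ≡⟨ subst-cong (λ { Z → refl ; (S x) → refl }) t ⟩
  subst (λ x → single (rename ρ u) (ext ρ x)) t      ≡⟨ subst-rename (single (rename ρ u)) (ext ρ) t ⟨
  subst (single (rename ρ u)) (rename (ext ρ) t)     ≡⟨ []-single (rename (ext ρ) t) (rename ρ u) ⟨
  rename (ext ρ) t [ rename ρ u ]                    ∎
  where open ≡-Reasoning

rename-ext-S-[Z] : ∀ {Γ Δ A B} (b : Tm (A ∷ Γ) Δ B) → rename (ext {B = A} (S {B = A})) b [ var Z ] ≡ b
rename-ext-S-[Z] b = begin
  rename (ext S) b [ var Z ]                    ≡⟨ []-single (rename (ext S) b) (var Z) ⟩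
  subst (single (var Z)) (rename (ext S) b)     ≡⟨ subst-rename (single (var Z)) (ext S) b ⟩
  subst (λ x → single (var Z) (ext S x)) b      ≡⟨ subst-cong (λ { Z → refl ; (S x) → refl }) b ⟩
  subst var b                                   ≡⟨ subst-var-id b ⟩
  b                                             ∎
  where open ≡-Reasoning

rename-sub-stoup : ∀ {Γ Γ' Δ A C} (ρ : Ren Γ Γ') (u : Tm Γ (just A) C) (t : Tm Γ Δ ⌈ A ⌉) →
                   rename ρ (sub-stoup u t) ≡ sub-stoup (rename ρ u) (rename ρ t)
rename-sub-stoup ρ svar t = refl
rename-sub-stoup ρ unitc t = refl
rename-sub-stoup ρ (pairc u v) t = cong₂ pairc (rename-sub-stoup ρ u t) (rename-sub-stoup ρ v t)
rename-sub-stoup ρ (fstc u) t = cong fstc (rename-sub-stoup ρ u t)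
rename-sub-stoup ρ (sndc u) t = cong sndc (rename-sub-stoup ρ u t)
rename-sub-stoup ρ (lamc u) t = cong lamc (trans (rename-sub-stoup (ext ρ) u (wk t)) (cong (sub-stoup (rename (ext ρ) u)) (rename-ext-wk ρ t)))
rename-sub-stoup ρ (appc u v) t = cong (λ z → appc z (rename ρ v)) (rename-sub-stoup ρ u t)
rename-sub-stoup ρ (letTop u v) t = cong (λ z → letTop z (rename ρ v)) (rename-sub-stoup ρ u t)
rename-sub-stoup ρ (letBang u v) t = cong (λ z → letBang z (rename (ext ρ) v)) (rename-sub-stoup ρ u t)
rename-sub-stoup ρ (tensor v u) t = cong (tensor (rename ρ v)) (rename-sub-stoup ρ u t)
rename-sub-stoup ρ (letTensor u v) t = cong (λ z → letTensor z (rename (ext ρ) v)) (rename-sub-stoup ρ u t)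
rename-sub-stoup ρ (abort u) t = cong abort (rename-sub-stoup ρ u t)
rename-sub-stoup ρ (inl u) t = cong inl (rename-sub-stoup ρ u t)
rename-sub-stoup ρ (inr u) t = cong inr (rename-sub-stoup ρ u t)
rename-sub-stoup ρ (case u a b) t = cong (λ z → case z (rename ρ a) (rename ρ b)) (rename-sub-stoup ρ u t)
rename-sub-stoup ρ (apph v u) t = cong (apph (rename ρ v)) (rename-sub-stoup ρ u t)

subst-sub-stoup : ∀ {Γ Γ' Δ A C} (σ : Sub Γ Γ') (u : Tm Γ (just A) C) (t : Tm Γ Δ ⌈ A ⌉) →
                  subst σ (sub-stoup u t) ≡ sub-stoup (subst σ u) (subst σ t)
subst-sub-stoup σ svar t = refl
subst-sub-stoup σ unitc t = refl
subst-sub-stoup σ (pairc u v) t = cong₂ pairc (subst-sub-stoup σ u t) (subst-sub-stoup σ v t)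
subst-sub-stoup σ (fstc u) t = cong fstc (subst-sub-stoup σ u t)
subst-sub-stoup σ (sndc u) t = cong sndc (subst-sub-stoup σ u t)
subst-sub-stoup σ (lamc u) t = cong lamc (trans (subst-sub-stoup (exts σ) u (wk t)) (cong (sub-stoup (subst (exts σ) u)) (subst-exts-wk σ t)))
subst-sub-stoup σ (appc u v) t = cong (λ z → appc z (subst σ v)) (subst-sub-stoup σ u t)
subst-sub-stoup σ (letTop u v) t = cong (λ z → letTop z (subst σ v)) (subst-sub-stoup σ u t)
subst-sub-stoup σ (letBang u v) t = cong (λ z → letBang z (subst (exts σ) v)) (subst-sub-stoup σ u t)
subst-sub-stoup σ (tensor v u) t = cong (tensor (subst σ v)) (subst-sub-stoup σ u t)
subst-sub-stoup σ (letTensor u v) t = cong (λ z → letTensor z (subst (exts σ) v)) (subst-sub-stoup σ u t)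
subst-sub-stoup σ (abort u) t = cong abort (subst-sub-stoup σ u t)
subst-sub-stoup σ (inl u) t = cong inl (subst-sub-stoup σ u t)
subst-sub-stoup σ (inr u) t = cong inr (subst-sub-stoup σ u t)
subst-sub-stoup σ (case u a b) t = cong (λ z → case z (subst σ a) (subst σ b)) (subst-sub-stoup σ u t)
subst-sub-stoup σ (apph v u) t = cong (apph (subst σ v)) (subst-sub-stoup σ u t)

rename-sub-stoup-≡ : ∀ {Γ Γ' Δ A C} (ρ : Ren Γ Γ') (c : Tm Γ (just A) C) {k : Tm Γ Δ ⌈ A ⌉} {c' k'} →
                     c' ≡ rename ρ c → k' ≡ rename ρ k → sub-stoup c' k' ≡ rename ρ (sub-stoup c k)
rename-sub-stoup-≡ ρ c {k} refl refl = sym (rename-sub-stoup ρ c k)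

subst-sub-stoup-≡ : ∀ {Γ Γ' Δ A C} (σ : Sub Γ Γ') (c : Tm Γ (just A) C) {k : Tm Γ Δ ⌈ A ⌉} {c' k'} →
                    c' ≡ subst σ c → k' ≡ subst σ k → sub-stoup c' k' ≡ subst σ (sub-stoup c k)
subst-sub-stoup-≡ σ c {k} refl refl = sym (subst-sub-stoup σ c k)

sub-stoup-assoc : ∀ {Γ Δ X Y C} (a : Tm Γ (just X) C) (b : Tm Γ (just Y) ⌈ X ⌉) (c : Tm Γ Δ ⌈ Y ⌉) →
                  sub-stoup (sub-stoup a b) c ≡ sub-stoup a (sub-stoup b c)
sub-stoup-assoc svar b c = refl
sub-stoup-assoc unitc b c = refl
sub-stoup-assoc (pairc u v) b c = cong₂ pairc (sub-stoup-assoc u b c) (sub-stoup-assoc v b c)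
sub-stoup-assoc (fstc u) b c = cong fstc (sub-stoup-assoc u b c)
sub-stoup-assoc (sndc u) b c = cong sndc (sub-stoup-assoc u b c)
sub-stoup-assoc (lamc u) b c = cong lamc (trans (sub-stoup-assoc u (wk b) (wk c)) (cong (sub-stoup u) (sym (rename-sub-stoup S b c))))
sub-stoup-assoc (appc u v) b c = cong (λ z → appc z v) (sub-stoup-assoc u b c)
sub-stoup-assoc (letTop u v) b c = cong (λ z → letTop z v) (sub-stoup-assoc u b c)
sub-stoup-assoc (letBang u v) b c = cong (λ z → letBang z v) (sub-stoup-assoc u b c)
sub-stoup-assoc (tensor v u) b c = cong (tensor v) (sub-stoup-assoc u b c)
sub-stoup-assoc (letTensor u v) b c = cong (λ z → letTensor z v) (sub-stoup-assoc u b c)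
sub-stoup-assoc (abort u) b c = cong abort (sub-stoup-assoc u b c)
sub-stoup-assoc (inl u) b c = cong inl (sub-stoup-assoc u b c)
sub-stoup-assoc (inr u) b c = cong inr (sub-stoup-assoc u b c)
sub-stoup-assoc (case u x y) b c = cong (λ z → case z x y) (sub-stoup-assoc u b c)
sub-stoup-assoc (apph v u) b c = cong (apph v) (sub-stoup-assoc u b c)

sub-stoup-svar : ∀ {Γ X C} (a : Tm Γ (just X) C) → sub-stoup a svar ≡ a
sub-stoup-svar svar = refl
sub-stoup-svar unitc = refl
sub-stoup-svar (pairc u v) = cong₂ pairc (sub-stoup-svar u) (sub-stoup-svar v)
sub-stoup-svar (fstc u) = cong fstc (sub-stoup-svar u)
sub-stoup-svar (sndc u) = cong sndc (sub-stoup-svar u)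
sub-stoup-svar (lamc u) = cong lamc (sub-stoup-svar u)
sub-stoup-svar (appc u v) = cong (λ z → appc z v) (sub-stoup-svar u)
sub-stoup-svar (letTop u v) = cong (λ z → letTop z v) (sub-stoup-svar u)
sub-stoup-svar (letBang u v) = cong (λ z → letBang z v) (sub-stoup-svar u)
sub-stoup-svar (tensor v u) = cong (tensor v) (sub-stoup-svar u)
sub-stoup-svar (letTensor u v) = cong (λ z → letTensor z v) (sub-stoup-svar u)
sub-stoup-svar (abort u) = cong abort (sub-stoup-svar u)
sub-stoup-svar (inl u) = cong inl (sub-stoup-svar u)
sub-stoup-svar (inr u) = cong inr (sub-stoup-svar u)
sub-stoup-svar (case u x y) = cong (λ z → case z x y) (sub-stoup-svar u)
sub-stoup-svar (apph v u) = cong (apph v) (sub-stoup-svar u)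

sub-stoup-[] : ∀ {Γ Δ A B C} (t : Tm (B ∷ Γ) (just A) C) (s : Tm Γ Δ ⌈ A ⌉) (u : Tm Γ nothing B) →
               sub-stoup t (wk s) [ u ] ≡ sub-stoup (t [ u ]) s
sub-stoup-[] t s u = begin
  sub-stoup t (wk s) [ u ]                                    ≡⟨ []-single (sub-stoup t (wk s)) u ⟩
  subst (single u) (sub-stoup t (wk s))                       ≡⟨ subst-sub-stoup (single u) t (wk s) ⟩
  sub-stoup (subst (single u) t) (subst (single u) (wk s))    ≡⟨ cong₂ sub-stoup (sym ([]-single t u)) single-wk ⟩
  sub-stoup (t [ u ]) s                                       ∎
  where
  open ≡-Reasoning
  single-wk : subst (single u) (wk s) ≡ s
  single-wk = trans (subst-rename (single u) S s) (subst-var-id s)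

≈-setoid : Ctx → Stoup → VTy → Setoid _ _
≈-setoid Γ Δ A = record
  { Carrier = Tm Γ Δ A
  ; _≈_ = _≈_
  ; isEquivalence = record { refl = ≈-refl ; sym = ≈-sym ; trans = ≈-trans }
  }

module ≈-Reasoning {Γ Δ A} = SetoidReasoning (≈-setoid Γ Δ A)

≡⇒≈ : ∀ {Γ Δ A} {t u : Tm Γ Δ A} → t ≡ u → t ≈ u
≡⇒≈ refl = ≈-refl

≈-≡ : ∀ {Γ Δ A} {t u v : Tm Γ Δ A} → t ≈ u → u ≡ v → t ≈ v
≈-≡ p refl = p

≡-≈ : ∀ {Γ Δ A} {t u v : Tm Γ Δ A} → t ≡ u → u ≈ v → t ≈ v
≡-≈ refl p = p

rename-sub-stoup-wk : ∀ {Γ Γ' Δ A B C} (ρ : Ren Γ Γ') (u : Tm Γ (just A) C) (k : Tm (B ∷ Γ) Δ ⌈ A ⌉) →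
                      rename (ext ρ) (sub-stoup (wk u) k) ≡ sub-stoup (wk (rename ρ u)) (rename (ext ρ) k)
rename-sub-stoup-wk ρ u k =
  trans (rename-sub-stoup (ext ρ) (wk u) k) (cong (λ v → sub-stoup v (rename (ext ρ) k)) (rename-ext-wk ρ u))

rename-≈ : ∀ {Γ Γ' Δ A} {t t' : Tm Γ Δ A} (ρ : Ren Γ Γ') → t ≈ t' → rename ρ t ≈ rename ρ t'
rename-≈ ρ ≈-refl = ≈-refl
rename-≈ ρ (≈-sym p) = ≈-sym (rename-≈ ρ p)
rename-≈ ρ (≈-trans p q) = ≈-trans (rename-≈ ρ p) (rename-≈ ρ q)
rename-≈ ρ (c-pair p q) = c-pair (rename-≈ ρ p) (rename-≈ ρ q)
rename-≈ ρ (c-fst p) = c-fst (rename-≈ ρ p)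
rename-≈ ρ (c-snd p) = c-snd (rename-≈ ρ p)
rename-≈ ρ (c-lam p) = c-lam (rename-≈ (ext ρ) p)
rename-≈ ρ (c-app p q) = c-app (rename-≈ ρ p) (rename-≈ ρ q)
rename-≈ ρ (c-pairc p q) = c-pairc (rename-≈ ρ p) (rename-≈ ρ q)
rename-≈ ρ (c-fstc p) = c-fstc (rename-≈ ρ p)
rename-≈ ρ (c-sndc p) = c-sndc (rename-≈ ρ p)
rename-≈ ρ (c-lamc p) = c-lamc (rename-≈ (ext ρ) p)
rename-≈ ρ (c-appc p q) = c-appc (rename-≈ ρ p) (rename-≈ ρ q)
rename-≈ ρ (c-letTop p q) = c-letTop (rename-≈ ρ p) (rename-≈ ρ q)
rename-≈ ρ (c-bang p) = c-bang (rename-≈ ρ p)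
rename-≈ ρ (c-letBang p q) = c-letBang (rename-≈ ρ p) (rename-≈ (ext ρ) q)
rename-≈ ρ (c-tensor p q) = c-tensor (rename-≈ ρ p) (rename-≈ ρ q)
rename-≈ ρ (c-letTensor p q) = c-letTensor (rename-≈ ρ p) (rename-≈ (ext ρ) q)
rename-≈ ρ (c-abort p) = c-abort (rename-≈ ρ p)
rename-≈ ρ (c-inl p) = c-inl (rename-≈ ρ p)
rename-≈ ρ (c-inr p) = c-inr (rename-≈ ρ p)
rename-≈ ρ (c-case p q r) = c-case (rename-≈ ρ p) (rename-≈ ρ q) (rename-≈ ρ r)
rename-≈ ρ (c-lamh p) = c-lamh (rename-≈ ρ p)
rename-≈ ρ (c-apph p q) = c-apph (rename-≈ ρ p) (rename-≈ ρ q)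
rename-≈ ρ (η-𝟙 t) = η-𝟙 _
rename-≈ ρ (β-×₁ t u) = β-×₁ _ _
rename-≈ ρ (β-×₂ t u) = β-×₂ _ _
rename-≈ ρ (η-× t) = η-× _
rename-≈ ρ (β-→ t u) = ≈-≡ (β-→ _ _) (sym (rename-[] ρ t u))
rename-≈ ρ (η-→ t) = ≡-≈ (cong (λ z → lam (app z (var Z))) (rename-ext-wk ρ t)) (η-→ _)
rename-≈ ρ (η-𝟙c t) = η-𝟙c _
rename-≈ ρ (β-&₁ t u) = β-&₁ _ _
rename-≈ ρ (β-&₂ t u) = β-&₂ _ _
rename-≈ ρ (η-& t) = η-& _
rename-≈ ρ (β-⇛ t u) = ≈-≡ (β-⇛ _ _) (sym (rename-[] ρ t u))
rename-≈ ρ (η-⇛ t) = ≡-≈ (cong (λ z → lamc (appc z (var Z))) (rename-ext-wk ρ t)) (η-⇛ _)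
rename-≈ ρ (β-𝕀 t) = β-𝕀 _
rename-≈ ρ (η-𝕀 t u) = ≡-≈ (cong (letTop _) (rename-sub-stoup ρ u top)) (≈-≡ (η-𝕀 _ _) (sym (rename-sub-stoup ρ u t)))
rename-≈ ρ (β-! t u) = ≈-≡ (β-! _ _) (sym (rename-[] ρ u t))
rename-≈ ρ (η-! t u) = ≡-≈ (cong (letBang _) (rename-sub-stoup-wk ρ u (bang (var Z))))
                            (≈-≡ (η-! _ _) (sym (rename-sub-stoup ρ u t)))
rename-≈ ρ (β-⊗ t s u) = ≈-≡ (β-⊗ _ _ _)
  (sym (trans (rename-sub-stoup ρ (u [ t ]) s) (cong (λ z → sub-stoup z (rename ρ s)) (rename-[] ρ u t))))
rename-≈ ρ (η-⊗ t u) = ≡-≈ (cong (letTensor _) (rename-sub-stoup-wk ρ u (tensor (var Z) svar)))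
                            (≈-≡ (η-⊗ _ _) (sym (rename-sub-stoup ρ u t)))
rename-≈ ρ (η-𝟘 t u) = ≈-≡ (η-𝟘 _ _) (sym (rename-sub-stoup ρ u t))
rename-≈ ρ (β-⊕₁ t u u') = ≈-≡ (β-⊕₁ _ _ _) (sym (rename-sub-stoup ρ u t))
rename-≈ ρ (β-⊕₂ t u u') = ≈-≡ (β-⊕₂ _ _ _) (sym (rename-sub-stoup ρ u' t))
rename-≈ ρ (η-⊕ t u) = ≡-≈ (cong₂ (case _) (rename-sub-stoup ρ u (inl svar)) (rename-sub-stoup ρ u (inr svar)))
                            (≈-≡ (η-⊕ _ _) (sym (rename-sub-stoup ρ u t)))
rename-≈ ρ (β-⊸ t u) = ≈-≡ (β-⊸ _ _) (sym (rename-sub-stoup ρ t u))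
rename-≈ ρ (η-⊸ t) = η-⊸ _

-- In the argument
-- this is a plain induction; in the body each axiom instance remains an
-- instance of the same axiom after plugging, by the syntactic laws above.
sub-stoup-congʳ : ∀ {Γ Δ A C} (w : Tm Γ (just A) C) {s s' : Tm Γ Δ ⌈ A ⌉} →
                  s ≈ s' → sub-stoup w s ≈ sub-stoup w s'
sub-stoup-congʳ svar p = p
sub-stoup-congʳ unitc p = ≈-refl
sub-stoup-congʳ (pairc u v) p = c-pairc (sub-stoup-congʳ u p) (sub-stoup-congʳ v p)
sub-stoup-congʳ (fstc u) p = c-fstc (sub-stoup-congʳ u p)
sub-stoup-congʳ (sndc u) p = c-sndc (sub-stoup-congʳ u p)
sub-stoup-congʳ (lamc u) p = c-lamc (sub-stoup-congʳ u (rename-≈ S p))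
sub-stoup-congʳ (appc u v) p = c-appc (sub-stoup-congʳ u p) ≈-refl
sub-stoup-congʳ (letTop u v) p = c-letTop (sub-stoup-congʳ u p) ≈-refl
sub-stoup-congʳ (letBang u v) p = c-letBang (sub-stoup-congʳ u p) ≈-refl
sub-stoup-congʳ (tensor v u) p = c-tensor ≈-refl (sub-stoup-congʳ u p)
sub-stoup-congʳ (letTensor u v) p = c-letTensor (sub-stoup-congʳ u p) ≈-refl
sub-stoup-congʳ (abort u) p = c-abort (sub-stoup-congʳ u p)
sub-stoup-congʳ (inl u) p = c-inl (sub-stoup-congʳ u p)
sub-stoup-congʳ (inr u) p = c-inr (sub-stoup-congʳ u p)
sub-stoup-congʳ (case u a b) p = c-case (sub-stoup-congʳ u p) ≈-refl ≈-refl
sub-stoup-congʳ (apph v u) p = c-apph ≈-refl (sub-stoup-congʳ u p)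

sub-stoup-congˡ : ∀ {Γ Δ A C} {t t' : Tm Γ (just A) C} →
                  t ≈ t' → (s : Tm Γ Δ ⌈ A ⌉) → sub-stoup t s ≈ sub-stoup t' s
sub-stoup-congˡ ≈-refl s = ≈-refl
sub-stoup-congˡ (≈-sym p) s = ≈-sym (sub-stoup-congˡ p s)
sub-stoup-congˡ (≈-trans p q) s = ≈-trans (sub-stoup-congˡ p s) (sub-stoup-congˡ q s)
sub-stoup-congˡ (c-pairc p q) s = c-pairc (sub-stoup-congˡ p s) (sub-stoup-congˡ q s)
sub-stoup-congˡ (c-fstc p) s = c-fstc (sub-stoup-congˡ p s)
sub-stoup-congˡ (c-sndc p) s = c-sndc (sub-stoup-congˡ p s)
sub-stoup-congˡ (c-lamc p) s = c-lamc (sub-stoup-congˡ p (wk s))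
sub-stoup-congˡ (c-appc p q) s = c-appc (sub-stoup-congˡ p s) q
sub-stoup-congˡ (c-letTop p q) s = c-letTop (sub-stoup-congˡ p s) q
sub-stoup-congˡ (c-letBang p q) s = c-letBang (sub-stoup-congˡ p s) q
sub-stoup-congˡ (c-tensor p q) s = c-tensor p (sub-stoup-congˡ q s)
sub-stoup-congˡ (c-letTensor p q) s = c-letTensor (sub-stoup-congˡ p s) q
sub-stoup-congˡ (c-abort p) s = c-abort (sub-stoup-congˡ p s)
sub-stoup-congˡ (c-inl p) s = c-inl (sub-stoup-congˡ p s)
sub-stoup-congˡ (c-inr p) s = c-inr (sub-stoup-congˡ p s)
sub-stoup-congˡ (c-case p q r) s = c-case (sub-stoup-congˡ p s) q r
sub-stoup-congˡ (c-apph p q) s = c-apph p (sub-stoup-congˡ q s)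
sub-stoup-congˡ (η-𝟙c t) s = η-𝟙c _
sub-stoup-congˡ (β-&₁ t u) s = β-&₁ _ _
sub-stoup-congˡ (β-&₂ t u) s = β-&₂ _ _
sub-stoup-congˡ (η-& t) s = η-& _
sub-stoup-congˡ (β-⇛ t u) s = ≈-≡ (β-⇛ _ _) (sub-stoup-[] t s u)
sub-stoup-congˡ (η-⇛ t) s = ≡-≈ (cong (λ z → lamc (appc z (var Z))) (sym (rename-sub-stoup S t s))) (η-⇛ _)
sub-stoup-congˡ (η-𝕀 t u) s = ≈-≡ (η-𝕀 _ u) (sym (sub-stoup-assoc u t s))
sub-stoup-congˡ (η-! t u) s = ≈-≡ (η-! _ u) (sym (sub-stoup-assoc u t s))
sub-stoup-congˡ (β-⊗ t s' u) s = ≈-≡ (β-⊗ t _ u) (sym (sub-stoup-assoc (u [ t ]) s' s))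
sub-stoup-congˡ (η-⊗ t u) s = ≈-≡ (η-⊗ _ u) (sym (sub-stoup-assoc u t s))
sub-stoup-congˡ (η-𝟘 t u) s = ≈-≡ (η-𝟘 _ u) (sym (sub-stoup-assoc u t s))
sub-stoup-congˡ (β-⊕₁ t u u') s = ≈-≡ (β-⊕₁ _ u u') (sym (sub-stoup-assoc u t s))
sub-stoup-congˡ (β-⊕₂ t u u') s = ≈-≡ (β-⊕₂ _ u u') (sym (sub-stoup-assoc u' t s))
sub-stoup-congˡ (η-⊕ t u) s = ≈-≡ (η-⊕ _ u) (sym (sub-stoup-assoc u t s))
sub-stoup-congˡ (β-⊸ t u) s = ≈-≡ (β-⊸ t _) (sym (sub-stoup-assoc t u s))

sub-stoup-cong : ∀ {Γ Δ A C} {t t' : Tm Γ (just A) C} {s s' : Tm Γ Δ ⌈ A ⌉} →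
                 t ≈ t' → s ≈ s' → sub-stoup t s ≈ sub-stoup t' s'
sub-stoup-cong {t' = t'} {s = s} p q = ≈-trans (sub-stoup-congˡ p s) (sub-stoup-congʳ t' q)

lamh-η : ∀ {Γ A B} {b : Tm Γ (just A) ⌈ B ⌉} {f : Tm Γ nothing (A ⊸ B)} →
         b ≈ apph f svar → lamh b ≈ f
lamh-η p = ≈-trans (c-lamh p) (η-⊸ _)

-- Linearity: plugging a term into the stoup of w commutes with the
-- eliminators of the positive connectives 𝟘, ⊕ and !A ⊗ B.  Each is an
-- instance of the corresponding η-axiom applied to w[elim(z)/z].

sub-stoup-abort : ∀ {Γ Δ X C} (w : Tm Γ (just X) ⌈ C ⌉) (s : Tm Γ Δ ⌈ 𝟘c ⌉) →
                  sub-stoup w (abort s) ≈ abort s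
sub-stoup-abort w s = ≈-sym (≈-≡ (η-𝟘 s (sub-stoup w (abort svar))) (sub-stoup-assoc w (abort svar) s))

sub-stoup-case : ∀ {Γ Δ X C A B} (w : Tm Γ (just X) ⌈ C ⌉) (s : Tm Γ Δ ⌈ A ⊕ B ⌉)
                 (a : Tm Γ (just A) ⌈ X ⌉) (b : Tm Γ (just B) ⌈ X ⌉) →
                 sub-stoup w (case s a b) ≈ case s (sub-stoup w a) (sub-stoup w b)
sub-stoup-case {Γ} {X = X} {C} {A} {B} w s a b = begin
  sub-stoup w (case s a b)                              ≡⟨ sub-stoup-assoc w (case svar a b) s ⟨
  sub-stoup w-case s                                    ≈⟨ η-⊕ s w-case ⟨
  case s (sub-stoup w-case (inl svar)) (sub-stoup w-case (inr svar))
    ≈⟨ c-case ≈-refl (branch (≈-≡ (β-⊕₁ svar a b) (sub-stoup-svar a)))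
                     (branch (≈-≡ (β-⊕₂ svar a b) (sub-stoup-svar b))) ⟩
  case s (sub-stoup w a) (sub-stoup w b)                ∎
  where
  open ≈-Reasoning
  w-case : Tm Γ (just (A ⊕ B)) ⌈ C ⌉
  w-case = sub-stoup w (case svar a b)
  branch : ∀ {Y} {x : Tm Γ (just Y) ⌈ A ⊕ B ⌉} {c : Tm Γ (just Y) ⌈ X ⌉} →
           case x a b ≈ c → sub-stoup w-case x ≈ sub-stoup w c
  branch {x = x} p = ≡-≈ (sub-stoup-assoc w (case svar a b) x) (sub-stoup-congʳ w p)

sub-stoup-letTensor : ∀ {Γ Δ X C A B} (w : Tm Γ (just X) ⌈ C ⌉) (s : Tm Γ Δ ⌈ ! A ⊗ B ⌉)
                      (b : Tm (A ∷ Γ) (just B) ⌈ X ⌉) →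
                      sub-stoup w (letTensor s b) ≈ letTensor s (sub-stoup (wk w) b)
sub-stoup-letTensor {Γ} {X = X} {C} {A} {B} w s b = begin
  sub-stoup w (letTensor s b)                                  ≡⟨ sub-stoup-assoc w (letTensor svar b) s ⟨
  sub-stoup w-let s                                            ≈⟨ η-⊗ s w-let ⟨
  letTensor s (sub-stoup (wk w-let) (tensor (var Z) svar))     ≈⟨ c-letTensor ≈-refl body ⟩
  letTensor s (sub-stoup (wk w) b)                             ∎
  where
  open ≈-Reasoning
  w-let : Tm Γ (just (! A ⊗ B)) ⌈ C ⌉
  w-let = sub-stoup w (letTensor svar b)
  b' : Tm (A ∷ A ∷ Γ) (just B) ⌈ X ⌉
  b' = rename (ext S) b
  body : sub-stoup (wk w-let) (tensor (var Z) svar) ≈ sub-stoup (wk w) b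
  body = begin
    sub-stoup (wk w-let) (tensor (var Z) svar)
      ≡⟨ cong (λ v → sub-stoup v (tensor (var Z) svar)) (rename-sub-stoup S w (letTensor svar b)) ⟩
    sub-stoup (sub-stoup (wk w) (letTensor svar b')) (tensor (var Z) svar)
      ≡⟨ sub-stoup-assoc (wk w) (letTensor svar b') (tensor (var Z) svar) ⟩
    sub-stoup (wk w) (letTensor (tensor (var Z) svar) b')
      ≈⟨ sub-stoup-congʳ (wk w) (β-⊗ (var Z) svar b') ⟩
    sub-stoup (wk w) (sub-stoup (b' [ var Z ]) svar)
      ≡⟨ cong (sub-stoup (wk w)) (trans (sub-stoup-svar _) (rename-ext-S-[Z] b)) ⟩
    sub-stoup (wk w) b
      ∎

module Properties (R : CTy) where
  open Translation R

  ren-ctx : ∀ {Γ Γ'} → Ren Γ Γ' → Ren (ctx Γ) (ctx Γ')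
  ren-ctx {A ∷ Γ} ρ Z = tvar (ρ Z)
  ren-ctx {A ∷ Γ} ρ (S x) = ren-ctx (λ y → ρ (S y)) x

  ren-ctx-tvar : ∀ {Γ Γ' A} (ρ : Ren Γ Γ') (x : Γ ∋ A) → ren-ctx ρ (tvar x) ≡ tvar (ρ x)
  ren-ctx-tvar ρ Z = refl
  ren-ctx-tvar ρ (S x) = ren-ctx-tvar (λ y → ρ (S y)) x

  ren-ctx-S : ∀ {Γ Γ' B A} (ρ : Ren Γ Γ') (x : ctx Γ ∋ A) →
              ren-ctx (λ y → S {B = B} (ρ y)) x ≡ S (ren-ctx ρ x)
  ren-ctx-S {A ∷ Γ} ρ Z = refl
  ren-ctx-S {A ∷ Γ} ρ (S x) = ren-ctx-S (λ y → ρ (S y)) x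

  ren-ctx-id : ∀ {Γ A} (x : ctx Γ ∋ A) → ren-ctx (λ y → y) x ≡ x
  ren-ctx-id {A ∷ Γ} Z = refl
  ren-ctx-id {A ∷ Γ} (S x) = trans (ren-ctx-S (λ y → y) x) (cong S (ren-ctx-id x))

  ren-ctx-ext : ∀ {Γ Γ' B} (ρ : Ren Γ Γ') → ren-ctx (ext {B = B} ρ) ≗ᴿ ext (ren-ctx ρ)
  ren-ctx-ext ρ Z = refl
  ren-ctx-ext ρ (S x) = ren-ctx-S ρ x

  ren-ctx-wk : ∀ {Γ B} → ren-ctx (S {Γ = Γ} {B = B}) ≗ᴿ S
  ren-ctx-wk x = trans (ren-ctx-S (λ y → y) x) (cong S (ren-ctx-id x))

  mutual
    val-rename : ∀ {Γ Γ' A} (ρ : Ren Γ Γ') (t : Tm Γ nothing A) →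
                 val (rename ρ t) ≡ rename (ren-ctx ρ) (val t)
    val-rename ρ (var x) = cong var (sym (ren-ctx-tvar ρ x))
    val-rename ρ unit = refl
    val-rename ρ (pair t u) = cong₂ pair (val-rename ρ t) (val-rename ρ u)
    val-rename ρ (fst t) = cong fst (val-rename ρ t)
    val-rename ρ (snd t) = cong snd (val-rename ρ t)
    val-rename ρ (lam t) = cong lam (val-rename-under ρ t)
    val-rename ρ (app t u) = cong₂ app (val-rename ρ t) (val-rename ρ u)
    val-rename ρ unitc = refl
    val-rename ρ (pairc t u) = cong₂ (λ a b → lamh (case svar (apph a svar) (apph b svar))) (val-rename ρ t) (val-rename ρ u)
    val-rename ρ (fstc t) = cong (λ a → lamh (apph a (inl svar))) (val-rename ρ t)
    val-rename ρ (sndc t) = cong (λ a → lamh (apph a (inr svar))) (val-rename ρ t)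
    val-rename ρ (lamc t) = cong (λ a → lamh (letTensor svar (apph a svar))) (val-rename-under ρ t)
    val-rename ρ (appc s t) = cong₂ (λ a b → lamh (apph a (tensor b svar))) (val-rename ρ s) (val-rename ρ t)
    val-rename ρ top = refl
    val-rename ρ (letTop t u) = cong₂ (λ a b → lamh (apph a (apph b svar))) (val-rename ρ t) (val-rename ρ u)
    val-rename ρ (bang t) = cong (λ a → lamh (appc svar a)) (val-rename ρ t)
    val-rename ρ (letBang t u) = cong₂ (λ a b → lamh (apph a (lamc (apph b svar)))) (val-rename ρ t) (val-rename-under ρ u)
    val-rename ρ (tensor t u) = cong₂ (λ a b → lamh (apph b (appc svar a))) (val-rename ρ t) (val-rename ρ u)
    val-rename ρ (letTensor s t) = cong₂ (λ a b → lamh (apph a (lamc b))) (val-rename ρ s) (comp-rename-under ρ t)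
    val-rename ρ (abort t) = cong (λ a → lamh (apph a unitc)) (val-rename ρ t)
    val-rename ρ (inl t) = cong (λ a → lamh (apph a (fstc svar))) (val-rename ρ t)
    val-rename ρ (inr t) = cong (λ a → lamh (apph a (sndc svar))) (val-rename ρ t)
    val-rename ρ (case s t u) = cong₃ (λ a b c → lamh (apph a (pairc b c))) (val-rename ρ s) (comp-rename ρ t) (comp-rename ρ u)
    val-rename ρ (lamh t) = cong lamh (comp-rename ρ t)
    val-rename ρ (apph s t) = cong₂ (λ a b → lamh (apph b (apph a svar))) (val-rename ρ s) (val-rename ρ t)

    comp-rename : ∀ {Γ Γ' D B} (ρ : Ren Γ Γ') (t : Tm Γ (just D) ⌈ B ⌉) →
                  comp (rename ρ t) ≡ rename (ren-ctx ρ) (comp t)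
    comp-rename ρ svar = refl
    comp-rename ρ unitc = refl
    comp-rename ρ (pairc t u) = cong₂ (case svar) (comp-rename ρ t) (comp-rename ρ u)
    comp-rename ρ (fstc t) = rename-sub-stoup-≡ (ren-ctx ρ) (comp t) (comp-rename ρ t) refl
    comp-rename ρ (sndc t) = rename-sub-stoup-≡ (ren-ctx ρ) (comp t) (comp-rename ρ t) refl
    comp-rename ρ (lamc t) = cong (letTensor svar) (comp-rename-under ρ t)
    comp-rename ρ (appc s t) = rename-sub-stoup-≡ (ren-ctx ρ) (comp s) (comp-rename ρ s) (cong (λ a → tensor a svar) (val-rename ρ t))
    comp-rename ρ (letTop t u) = rename-sub-stoup-≡ (ren-ctx ρ) (comp t) (comp-rename ρ t) (cong (λ a → apph a svar) (val-rename ρ u))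
    comp-rename ρ (letBang t u) = rename-sub-stoup-≡ (ren-ctx ρ) (comp t) (comp-rename ρ t) (cong (λ a → lamc (apph a svar)) (val-rename-under ρ u))
    comp-rename ρ (tensor t u) = rename-sub-stoup-≡ (ren-ctx ρ) (comp u) (comp-rename ρ u) (cong (appc svar) (val-rename ρ t))
    comp-rename ρ (letTensor s t) = rename-sub-stoup-≡ (ren-ctx ρ) (comp s) (comp-rename ρ s) (cong lamc (comp-rename-under ρ t))
    comp-rename ρ (abort t) = rename-sub-stoup-≡ (ren-ctx ρ) (comp t) (comp-rename ρ t) refl
    comp-rename ρ (inl t) = rename-sub-stoup-≡ (ren-ctx ρ) (comp t) (comp-rename ρ t) refl
    comp-rename ρ (inr t) = rename-sub-stoup-≡ (ren-ctx ρ) (comp t) (comp-rename ρ t) refl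
    comp-rename ρ (case s t u) = rename-sub-stoup-≡ (ren-ctx ρ) (comp s) (comp-rename ρ s) (cong₂ pairc (comp-rename ρ t) (comp-rename ρ u))
    comp-rename ρ (apph s t) = rename-sub-stoup-≡ (ren-ctx ρ) (comp t) (comp-rename ρ t) (cong (λ a → apph a svar) (val-rename ρ s))

    val-rename-under : ∀ {Γ Γ' A B} (ρ : Ren Γ Γ') (t : Tm (B ∷ Γ) nothing A) →
                  val (rename (ext ρ) t) ≡ rename (ext (ren-ctx ρ)) (val t)
    val-rename-under ρ t = trans (val-rename (ext ρ) t) (rename-cong (ren-ctx-ext ρ) (val t))

    comp-rename-under : ∀ {Γ Γ' D C B} (ρ : Ren Γ Γ') (t : Tm (B ∷ Γ) (just D) ⌈ C ⌉) →
                   comp (rename (ext ρ) t) ≡ rename (ext (ren-ctx ρ)) (comp t)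
    comp-rename-under ρ t = trans (comp-rename (ext ρ) t) (rename-cong (ren-ctx-ext ρ) (comp t))

  val-wk : ∀ {Γ A B} (t : Tm Γ nothing A) → val (wk {B = B} t) ≡ wk (val t)
  val-wk t = trans (val-rename S t) (rename-cong ren-ctx-wk (val t))

  comp-wk : ∀ {Γ D C B} (t : Tm Γ (just D) ⌈ C ⌉) → comp (wk {B = B} t) ≡ wk (comp t)
  comp-wk t = trans (comp-rename S t) (rename-cong ren-ctx-wk (comp t))

  sub-ctx : ∀ {Γ Γ'} → Sub Γ Γ' → Sub (ctx Γ) (ctx Γ')
  sub-ctx {A ∷ Γ} σ Z = val (σ Z)
  sub-ctx {A ∷ Γ} σ (S x) = sub-ctx (λ y → σ (S y)) x

  sub-ctx-tvar : ∀ {Γ Γ' A} (σ : Sub Γ Γ') (x : Γ ∋ A) → sub-ctx σ (tvar x) ≡ val (σ x)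
  sub-ctx-tvar σ Z = refl
  sub-ctx-tvar σ (S x) = sub-ctx-tvar (λ y → σ (S y)) x

  sub-ctx-wk : ∀ {Γ Γ' B A} (σ : Sub Γ Γ') (x : ctx Γ ∋ A) →
               sub-ctx (λ y → wk {B = B} (σ y)) x ≡ wk (sub-ctx σ x)
  sub-ctx-wk {A ∷ Γ} σ Z = val-wk (σ Z)
  sub-ctx-wk {A ∷ Γ} σ (S x) = sub-ctx-wk (λ y → σ (S y)) x

  sub-ctx-exts : ∀ {Γ Γ' B} (σ : Sub Γ Γ') → sub-ctx (exts {B = B} σ) ≗ˢ exts (sub-ctx σ)
  sub-ctx-exts σ Z = refl
  sub-ctx-exts σ (S x) = sub-ctx-wk σ x

  sub-ctx-var : ∀ {Γ Γ' A} (ρ : Ren Γ Γ') (x : ctx Γ ∋ A) →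
                sub-ctx (λ y → var (ρ y)) x ≡ var (ren-ctx ρ x)
  sub-ctx-var {A ∷ Γ} ρ Z = refl
  sub-ctx-var {A ∷ Γ} ρ (S x) = sub-ctx-var (λ y → ρ (S y)) x

  mutual
    val-subst : ∀ {Γ Γ' A} (σ : Sub Γ Γ') (t : Tm Γ nothing A) →
                val (subst σ t) ≡ subst (sub-ctx σ) (val t)
    val-subst σ (var x) = sym (sub-ctx-tvar σ x)
    val-subst σ unit = refl
    val-subst σ (pair t u) = cong₂ pair (val-subst σ t) (val-subst σ u)
    val-subst σ (fst t) = cong fst (val-subst σ t)
    val-subst σ (snd t) = cong snd (val-subst σ t)
    val-subst σ (lam t) = cong lam (val-subst-under σ t)
    val-subst σ (app t u) = cong₂ app (val-subst σ t) (val-subst σ u)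
    val-subst σ unitc = refl
    val-subst σ (pairc t u) = cong₂ (λ a b → lamh (case svar (apph a svar) (apph b svar))) (val-subst σ t) (val-subst σ u)
    val-subst σ (fstc t) = cong (λ a → lamh (apph a (inl svar))) (val-subst σ t)
    val-subst σ (sndc t) = cong (λ a → lamh (apph a (inr svar))) (val-subst σ t)
    val-subst σ (lamc t) = cong (λ a → lamh (letTensor svar (apph a svar))) (val-subst-under σ t)
    val-subst σ (appc s t) = cong₂ (λ a b → lamh (apph a (tensor b svar))) (val-subst σ s) (val-subst σ t)
    val-subst σ top = refl
    val-subst σ (letTop t u) = cong₂ (λ a b → lamh (apph a (apph b svar))) (val-subst σ t) (val-subst σ u)
    val-subst σ (bang t) = cong (λ a → lamh (appc svar a)) (val-subst σ t)
    val-subst σ (letBang t u) = cong₂ (λ a b → lamh (apph a (lamc (apph b svar)))) (val-subst σ t) (val-subst-under σ u)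
    val-subst σ (tensor t u) = cong₂ (λ a b → lamh (apph b (appc svar a))) (val-subst σ t) (val-subst σ u)
    val-subst σ (letTensor s t) = cong₂ (λ a b → lamh (apph a (lamc b))) (val-subst σ s) (comp-subst-under σ t)
    val-subst σ (abort t) = cong (λ a → lamh (apph a unitc)) (val-subst σ t)
    val-subst σ (inl t) = cong (λ a → lamh (apph a (fstc svar))) (val-subst σ t)
    val-subst σ (inr t) = cong (λ a → lamh (apph a (sndc svar))) (val-subst σ t)
    val-subst σ (case s t u) = cong₃ (λ a b c → lamh (apph a (pairc b c))) (val-subst σ s) (comp-subst σ t) (comp-subst σ u)
    val-subst σ (lamh t) = cong lamh (comp-subst σ t)
    val-subst σ (apph s t) = cong₂ (λ a b → lamh (apph b (apph a svar))) (val-subst σ s) (val-subst σ t)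

    comp-subst : ∀ {Γ Γ' D B} (σ : Sub Γ Γ') (t : Tm Γ (just D) ⌈ B ⌉) →
                 comp (subst σ t) ≡ subst (sub-ctx σ) (comp t)
    comp-subst σ svar = refl
    comp-subst σ unitc = refl
    comp-subst σ (pairc t u) = cong₂ (case svar) (comp-subst σ t) (comp-subst σ u)
    comp-subst σ (fstc t) = subst-sub-stoup-≡ (sub-ctx σ) (comp t) (comp-subst σ t) refl
    comp-subst σ (sndc t) = subst-sub-stoup-≡ (sub-ctx σ) (comp t) (comp-subst σ t) refl
    comp-subst σ (lamc t) = cong (letTensor svar) (comp-subst-under σ t)
    comp-subst σ (appc s t) = subst-sub-stoup-≡ (sub-ctx σ) (comp s) (comp-subst σ s) (cong (λ a → tensor a svar) (val-subst σ t))
    comp-subst σ (letTop t u) = subst-sub-stoup-≡ (sub-ctx σ) (comp t) (comp-subst σ t) (cong (λ a → apph a svar) (val-subst σ u))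
    comp-subst σ (letBang t u) = subst-sub-stoup-≡ (sub-ctx σ) (comp t) (comp-subst σ t) (cong (λ a → lamc (apph a svar)) (val-subst-under σ u))
    comp-subst σ (tensor t u) = subst-sub-stoup-≡ (sub-ctx σ) (comp u) (comp-subst σ u) (cong (appc svar) (val-subst σ t))
    comp-subst σ (letTensor s t) = subst-sub-stoup-≡ (sub-ctx σ) (comp s) (comp-subst σ s) (cong lamc (comp-subst-under σ t))
    comp-subst σ (abort t) = subst-sub-stoup-≡ (sub-ctx σ) (comp t) (comp-subst σ t) refl
    comp-subst σ (inl t) = subst-sub-stoup-≡ (sub-ctx σ) (comp t) (comp-subst σ t) refl
    comp-subst σ (inr t) = subst-sub-stoup-≡ (sub-ctx σ) (comp t) (comp-subst σ t) refl
    comp-subst σ (case s t u) = subst-sub-stoup-≡ (sub-ctx σ) (comp s) (comp-subst σ s) (cong₂ pairc (comp-subst σ t) (comp-subst σ u))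
    comp-subst σ (apph s t) = subst-sub-stoup-≡ (sub-ctx σ) (comp t) (comp-subst σ t) (cong (λ a → apph a svar) (val-subst σ s))

    val-subst-under : ∀ {Γ Γ' A B} (σ : Sub Γ Γ') (t : Tm (B ∷ Γ) nothing A) →
                  val (subst (exts σ) t) ≡ subst (exts (sub-ctx σ)) (val t)
    val-subst-under σ t = trans (val-subst (exts σ) t) (subst-cong (sub-ctx-exts σ) (val t))

    comp-subst-under : ∀ {Γ Γ' D C B} (σ : Sub Γ Γ') (t : Tm (B ∷ Γ) (just D) ⌈ C ⌉) →
                   comp (subst (exts σ) t) ≡ subst (exts (sub-ctx σ)) (comp t)
    comp-subst-under σ t = trans (comp-subst (exts σ) t) (subst-cong (sub-ctx-exts σ) (comp t))

  sub-ctx-single : ∀ {Γ B} (u : Tm Γ nothing B) → sub-ctx (single u) ≗ˢ single (val u)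
  sub-ctx-single u Z = refl
  sub-ctx-single u (S x) = trans (sub-ctx-var (λ y → y) x) (cong var (ren-ctx-id x))

  val-[] : ∀ {Γ A B} (t : Tm (B ∷ Γ) nothing A) (u : Tm Γ nothing B) →
           val (t [ u ]) ≡ val t [ val u ]
  val-[] t u = begin
    val (t [ u ])                         ≡⟨ cong val ([]-single t u) ⟩
    val (subst (single u) t)              ≡⟨ val-subst (single u) t ⟩
    subst (sub-ctx (single u)) (val t)    ≡⟨ subst-cong (sub-ctx-single u) (val t) ⟩
    subst (single (val u)) (val t)        ≡⟨ []-single (val t) (val u) ⟨
    val t [ val u ]                       ∎
    where open ≡-Reasoning

  comp-[] : ∀ {Γ D C B} (t : Tm (B ∷ Γ) (just D) ⌈ C ⌉) (u : Tm Γ nothing B) →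
            comp (t [ u ]) ≡ comp t [ val u ]
  comp-[] t u = begin
    comp (t [ u ])                        ≡⟨ cong comp ([]-single t u) ⟩
    comp (subst (single u) t)             ≡⟨ comp-subst (single u) t ⟩
    subst (sub-ctx (single u)) (comp t)   ≡⟨ subst-cong (sub-ctx-single u) (comp t) ⟩
    subst (single (val u)) (comp t)       ≡⟨ []-single (comp t) (val u) ⟨
    comp t [ val u ]                      ∎
    where open ≡-Reasoning

  -- Translation of stoup substitution: with stoup in the result, the CPS
  -- reading reverses the order, (u[t/z])∘ ≈ t∘[u∘/k].  The cases pairc and
  -- lamc need linearity of t∘ (it commutes with case and let !x⊗y).
  mutual
    comp-sub-stoup : ∀ {Γ A B D} (u : Tm Γ (just A) ⌈ B ⌉) (t : Tm Γ (just D) ⌈ A ⌉) →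
                     comp (sub-stoup u t) ≈ sub-stoup (comp t) (comp u)
    comp-sub-stoup svar t = ≈-sym (≡⇒≈ (sub-stoup-svar (comp t)))
    comp-sub-stoup unitc t = ≈-sym (sub-stoup-abort (comp t) svar)
    comp-sub-stoup (pairc u v) t = begin
      case svar (comp (sub-stoup u t)) (comp (sub-stoup v t))
        ≈⟨ c-case ≈-refl (comp-sub-stoup u t) (comp-sub-stoup v t) ⟩
      case svar (sub-stoup (comp t) (comp u)) (sub-stoup (comp t) (comp v))
        ≈⟨ sub-stoup-case (comp t) svar (comp u) (comp v) ⟨
      sub-stoup (comp t) (case svar (comp u) (comp v))
        ∎
      where open ≈-Reasoning
    comp-sub-stoup (lamc u) t = begin
      letTensor svar (comp (sub-stoup u (wk t)))
        ≈⟨ c-letTensor ≈-refl (comp-sub-stoup u (wk t)) ⟩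
      letTensor svar (sub-stoup (comp (wk t)) (comp u))
        ≡⟨ cong (λ c → letTensor svar (sub-stoup c (comp u))) (comp-wk t) ⟩
      letTensor svar (sub-stoup (wk (comp t)) (comp u))
        ≈⟨ sub-stoup-letTensor (comp t) svar (comp u) ⟨
      sub-stoup (comp t) (letTensor svar (comp u))
        ∎
      where open ≈-Reasoning
    comp-sub-stoup (fstc u) t = comp-sub-stoup-then u t
    comp-sub-stoup (sndc u) t = comp-sub-stoup-then u t
    comp-sub-stoup (appc u v) t = comp-sub-stoup-then u t
    comp-sub-stoup (letTop u v) t = comp-sub-stoup-then u t
    comp-sub-stoup (letBang u v) t = comp-sub-stoup-then u t
    comp-sub-stoup (tensor v u) t = comp-sub-stoup-then u t
    comp-sub-stoup (letTensor u v) t = comp-sub-stoup-then u t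
    comp-sub-stoup (abort u) t = comp-sub-stoup-then u t
    comp-sub-stoup (inl u) t = comp-sub-stoup-then u t
    comp-sub-stoup (inr u) t = comp-sub-stoup-then u t
    comp-sub-stoup (case u a b) t = comp-sub-stoup-then u t
    comp-sub-stoup (apph v u) t = comp-sub-stoup-then u t

    comp-sub-stoup-then : ∀ {Γ A B D C} (u : Tm Γ (just A) ⌈ B ⌉) (t : Tm Γ (just D) ⌈ A ⌉)
                          {K : Tm (ctx Γ) (just C) ⌈ cty B ⌉} →
                          sub-stoup (comp (sub-stoup u t)) K ≈ sub-stoup (comp t) (sub-stoup (comp u) K)
    comp-sub-stoup-then u t {K} = ≈-≡ (sub-stoup-congˡ (comp-sub-stoup u t) K) (sub-stoup-assoc (comp t) (comp u) K)

  mutual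
    val-sub-stoup : ∀ {Γ A B} (u : Tm Γ (just A) ⌈ B ⌉) (t : Tm Γ nothing ⌈ A ⌉) →
                    val (sub-stoup u t) ≈ lamh (apph (val t) (comp u))
    val-sub-stoup svar t = ≈-sym (η-⊸ (val t))
    val-sub-stoup unitc t = c-lamh (≈-sym (sub-stoup-abort (apph (val t) svar) svar))
    val-sub-stoup (pairc u v) t = c-lamh (begin
      case svar (apph (val (sub-stoup u t)) svar) (apph (val (sub-stoup v t)) svar)
        ≈⟨ c-case ≈-refl (continue u) (continue v) ⟩
      case svar (apph (val t) (comp u)) (apph (val t) (comp v))
        ≈⟨ sub-stoup-case (apph (val t) svar) svar (comp u) (comp v) ⟨
      apph (val t) (case svar (comp u) (comp v))
        ∎)
      where
      open ≈-Reasoning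
      continue : ∀ {X} (w : Tm _ (just _) ⌈ X ⌉) → apph (val (sub-stoup w t)) svar ≈ apph (val t) (comp w)
      continue w = ≈-≡ (val-sub-stoup-app w t) (cong (apph (val t)) (sub-stoup-svar (comp w)))
    val-sub-stoup (lamc u) t = c-lamh (begin
      letTensor svar (apph (val (sub-stoup u (wk t))) svar)
        ≈⟨ c-letTensor ≈-refl (val-sub-stoup-app u (wk t)) ⟩
      letTensor svar (apph (val (wk t)) (sub-stoup (comp u) svar))
        ≡⟨ cong (letTensor svar) (cong₂ apph (val-wk t) (sub-stoup-svar (comp u))) ⟩
      letTensor svar (apph (wk (val t)) (comp u))
        ≈⟨ sub-stoup-letTensor (apph (val t) svar) svar (comp u) ⟨
      apph (val t) (letTensor svar (comp u))
        ∎)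
      where open ≈-Reasoning
    val-sub-stoup (fstc u) t = c-lamh (val-sub-stoup-app u t)
    val-sub-stoup (sndc u) t = c-lamh (val-sub-stoup-app u t)
    val-sub-stoup (appc u v) t = c-lamh (val-sub-stoup-app u t)
    val-sub-stoup (letTop u v) t = c-lamh (val-sub-stoup-app u t)
    val-sub-stoup (letBang u v) t = c-lamh (val-sub-stoup-app u t)
    val-sub-stoup (tensor v u) t = c-lamh (val-sub-stoup-app u t)
    val-sub-stoup (letTensor u v) t = c-lamh (val-sub-stoup-app u t)
    val-sub-stoup (abort u) t = c-lamh (val-sub-stoup-app u t)
    val-sub-stoup (inl u) t = c-lamh (val-sub-stoup-app u t)
    val-sub-stoup (inr u) t = c-lamh (val-sub-stoup-app u t)
    val-sub-stoup (case u a b) t = c-lamh (val-sub-stoup-app u t)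
    val-sub-stoup (apph v u) t = c-lamh (val-sub-stoup-app u t)

    val-sub-stoup-app : ∀ {Γ A B Δ} (u : Tm Γ (just A) ⌈ B ⌉) (t : Tm Γ nothing ⌈ A ⌉)
                        {K : Tm (ctx Γ) Δ ⌈ cty B ⌉} →
                        apph (val (sub-stoup u t)) K ≈ apph (val t) (sub-stoup (comp u) K)
    val-sub-stoup-app u t = ≈-trans (c-apph (val-sub-stoup u t) ≈-refl) (β-⊸ _ _)

  -- An axiom  elim(t, K-data) ≈ u[t/z]  translates, in both translations,
  -- to  t applied to K  versus  t applied to u∘, so it suffices to show that
  -- the translated continuation K is equal to u∘.
  val-plug : ∀ {Γ A B} (u : Tm Γ (just A) ⌈ B ⌉) (t : Tm Γ nothing ⌈ A ⌉) {K} →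
             K ≈ comp u → lamh (apph (val t) K) ≈ val (sub-stoup u t)
  val-plug u t p = ≈-trans (c-lamh (c-apph ≈-refl p)) (≈-sym (val-sub-stoup u t))

  comp-plug : ∀ {Γ A B D} (u : Tm Γ (just A) ⌈ B ⌉) (t : Tm Γ (just D) ⌈ A ⌉) {K} →
              K ≈ comp u → sub-stoup (comp t) K ≈ comp (sub-stoup u t)
  comp-plug u t p = ≈-trans (sub-stoup-congʳ (comp t) p) (≈-sym (comp-sub-stoup u t))

  -- For the η-axioms of the positive connectives 𝕀, !, ⊗ and ⊕ the
  -- continuation is, up to β, an η-expansion of u∘ for the dual connective:
  -- u∘ itself for 𝕀, a ⇒-expansion for ! and ⊗, a &-expansion for ⊕.

  η-continuation-𝕀 : ∀ {Γ A} (u : Tm Γ (just 𝕀) ⌈ A ⌉) → apph (val (sub-stoup u top)) svar ≈ comp u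
  η-continuation-𝕀 u = begin
    apph (val (sub-stoup u top)) svar             ≈⟨ val-sub-stoup-app u top ⟩
    apph (lamh svar) (sub-stoup (comp u) svar)    ≈⟨ β-⊸ _ _ ⟩
    sub-stoup (comp u) svar                       ≡⟨ sub-stoup-svar (comp u) ⟩
    comp u                                        ∎
    where open ≈-Reasoning

  η-continuation-! : ∀ {Γ A B} (u : Tm Γ (just (! A)) ⌈ B ⌉) →
                     lamc (apph (val (sub-stoup (wk {B = A} u) (bang (var Z)))) svar) ≈ comp u
  η-continuation-! u = begin
    lamc (apph (val (sub-stoup (wk u) (bang (var Z)))) svar)
      ≈⟨ c-lamc (val-sub-stoup-app (wk u) (bang (var Z))) ⟩
    lamc (apph (lamh (appc svar (var Z))) (sub-stoup (comp (wk u)) svar))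
      ≈⟨ c-lamc (β-⊸ _ _) ⟩
    lamc (appc (sub-stoup (comp (wk u)) svar) (var Z))
      ≡⟨ cong (λ c → lamc (appc c (var Z))) (trans (sub-stoup-svar _) (comp-wk u)) ⟩
    lamc (appc (wk (comp u)) (var Z))
      ≈⟨ η-⇛ _ ⟩
    comp u
      ∎
    where open ≈-Reasoning

  η-continuation-⊗ : ∀ {Γ A B C} (u : Tm Γ (just (! A ⊗ B)) ⌈ C ⌉) →
                     lamc (comp (sub-stoup (wk {B = A} u) (tensor (var Z) svar))) ≈ comp u
  η-continuation-⊗ u = begin
    lamc (comp (sub-stoup (wk u) (tensor (var Z) svar)))    ≈⟨ c-lamc (comp-sub-stoup (wk u) (tensor (var Z) svar)) ⟩
    lamc (appc (comp (wk u)) (var Z))                       ≡⟨ cong (λ c → lamc (appc c (var Z))) (comp-wk u) ⟩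
    lamc (appc (wk (comp u)) (var Z))                       ≈⟨ η-⇛ _ ⟩
    comp u                                                  ∎
    where open ≈-Reasoning

  η-continuation-⊕ : ∀ {Γ A B C} (u : Tm Γ (just (A ⊕ B)) ⌈ C ⌉) →
                     pairc (comp (sub-stoup u (inl svar))) (comp (sub-stoup u (inr svar))) ≈ comp u
  η-continuation-⊕ u = ≈-trans (c-pairc (comp-sub-stoup u (inl svar)) (comp-sub-stoup u (inr svar))) (η-& _)

  -- For the value connectives the axioms are
  -- preserved verbatim (using that • commutes with substitution); a β- or
  -- η-axiom of a negative connective becomes the β/η-axiom of its dual
  -- positive connective followed by η for ⊸; the axioms of the positive
  -- connectives go through val-plug / comp-plug.
  mutual
    val-sound : ∀ {Γ A} {t u : Tm Γ nothing A} → t ≈ u → val t ≈ val u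
    val-sound ≈-refl = ≈-refl
    val-sound (≈-sym p) = ≈-sym (val-sound p)
    val-sound (≈-trans p q) = ≈-trans (val-sound p) (val-sound q)
    val-sound (c-pair p q) = c-pair (val-sound p) (val-sound q)
    val-sound (c-fst p) = c-fst (val-sound p)
    val-sound (c-snd p) = c-snd (val-sound p)
    val-sound (c-lam p) = c-lam (val-sound p)
    val-sound (c-app p q) = c-app (val-sound p) (val-sound q)
    val-sound (c-pairc p q) = c-lamh (c-case ≈-refl (c-apph (val-sound p) ≈-refl) (c-apph (val-sound q) ≈-refl))
    val-sound (c-fstc p) = c-lamh (c-apph (val-sound p) ≈-refl)
    val-sound (c-sndc p) = c-lamh (c-apph (val-sound p) ≈-refl)
    val-sound (c-lamc p) = c-lamh (c-letTensor ≈-refl (c-apph (val-sound p) ≈-refl))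
    val-sound (c-appc p q) = c-lamh (c-apph (val-sound p) (c-tensor (val-sound q) ≈-refl))
    val-sound (c-letTop p q) = c-lamh (c-apph (val-sound p) (c-apph (val-sound q) ≈-refl))
    val-sound (c-bang p) = c-lamh (c-appc ≈-refl (val-sound p))
    val-sound (c-letBang p q) = c-lamh (c-apph (val-sound p) (c-lamc (c-apph (val-sound q) ≈-refl)))
    val-sound (c-tensor p q) = c-lamh (c-apph (val-sound q) (c-appc ≈-refl (val-sound p)))
    val-sound (c-letTensor p q) = c-lamh (c-apph (val-sound p) (c-lamc (comp-sound q)))
    val-sound (c-abort p) = c-lamh (c-apph (val-sound p) ≈-refl)
    val-sound (c-inl p) = c-lamh (c-apph (val-sound p) ≈-refl)
    val-sound (c-inr p) = c-lamh (c-apph (val-sound p) ≈-refl)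
    val-sound (c-case p q r) = c-lamh (c-apph (val-sound p) (c-pairc (comp-sound q) (comp-sound r)))
    val-sound (c-lamh p) = c-lamh (comp-sound p)
    val-sound (c-apph p q) = c-lamh (c-apph (val-sound q) (c-apph (val-sound p) ≈-refl))
    val-sound (η-𝟙 t) = η-𝟙 _
    val-sound (β-×₁ t u) = β-×₁ _ _
    val-sound (β-×₂ t u) = β-×₂ _ _
    val-sound (η-× t) = η-× _
    val-sound (β-→ t u) = ≈-≡ (β-→ _ _) (sym (val-[] t u))
    val-sound (η-→ t) = ≡-≈ (cong (λ f → lam (app f (var Z))) (val-wk t)) (η-→ _)
    val-sound (β-⊸ t u) = val-plug t u (≈-≡ (β-⊸ _ _) (sub-stoup-svar (comp t)))
    val-sound (η-⊸ t) = η-⊸ _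
    -- negative connectives: 𝟙c, & and ⇒ become 𝟘c, ⊕ and ⊗
    val-sound (η-𝟙c t) = ≈-sym (lamh-η (η-𝟘 svar (apph (val t) svar)))
    val-sound (β-&₁ t u) = lamh-η (≈-trans (β-⊸ _ _) (β-⊕₁ _ _ _))
    val-sound (β-&₂ t u) = lamh-η (≈-trans (β-⊸ _ _) (β-⊕₂ _ _ _))
    val-sound (η-& t) = lamh-η (≈-trans (c-case ≈-refl (β-⊸ _ _) (β-⊸ _ _)) (η-⊕ svar (apph (val t) svar)))
    val-sound (β-⇛ t u) = lamh-η (≈-≡ (≈-trans (β-⊸ _ _) (β-⊗ _ _ _)) (cong (λ f → apph f svar) (sym (val-[] t u))))
    val-sound (η-⇛ t) = lamh-η (≈-trans (c-letTensor ≈-refl (≈-≡ (β-⊸ _ _) (cong (λ f → apph f (tensor (var Z) svar)) (val-wk t))))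
                                        (η-⊗ svar (apph (val t) svar)))
    val-sound (β-𝕀 t) = lamh-η (β-⊸ _ _)
    val-sound (η-𝕀 t u) = val-plug u t (η-continuation-𝕀 u)
    val-sound (β-! t u) = lamh-η (≈-≡ (≈-trans (β-⊸ _ _) (β-⇛ _ _)) (cong (λ f → apph f svar) (sym (val-[] u t))))
    val-sound (η-! t u) = val-plug u t (η-continuation-! u)
    val-sound (β-⊗ t s u) = ≈-trans (c-lamh (β-⊸ _ _)) (val-plug (u [ t ]) s (≈-≡ (β-⇛ _ _) (sym (comp-[] u t))))
    val-sound (η-⊗ t u) = val-plug u t (η-continuation-⊗ u)
    val-sound (η-𝟘 t u) = val-plug u t (≈-sym (η-𝟙c (comp u)))
    val-sound (β-⊕₁ t u u') = ≈-trans (c-lamh (β-⊸ _ _)) (val-plug u t (β-&₁ _ _))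
    val-sound (β-⊕₂ t u u') = ≈-trans (c-lamh (β-⊸ _ _)) (val-plug u' t (β-&₂ _ _))
    val-sound (η-⊕ t u) = val-plug u t (η-continuation-⊕ u)

    comp-sound : ∀ {Γ A B} {t u : Tm Γ (just A) ⌈ B ⌉} → t ≈ u → comp t ≈ comp u
    comp-sound ≈-refl = ≈-refl
    comp-sound (≈-sym p) = ≈-sym (comp-sound p)
    comp-sound (≈-trans p q) = ≈-trans (comp-sound p) (comp-sound q)
    comp-sound (c-pairc p q) = c-case ≈-refl (comp-sound p) (comp-sound q)
    comp-sound (c-fstc p) = sub-stoup-congˡ (comp-sound p) _
    comp-sound (c-sndc p) = sub-stoup-congˡ (comp-sound p) _
    comp-sound (c-lamc p) = c-letTensor ≈-refl (comp-sound p)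
    comp-sound (c-appc p q) = sub-stoup-cong (comp-sound p) (c-tensor (val-sound q) ≈-refl)
    comp-sound (c-letTop p q) = sub-stoup-cong (comp-sound p) (c-apph (val-sound q) ≈-refl)
    comp-sound (c-letBang p q) = sub-stoup-cong (comp-sound p) (c-lamc (c-apph (val-sound q) ≈-refl))
    comp-sound (c-tensor p q) = sub-stoup-cong (comp-sound q) (c-appc ≈-refl (val-sound p))
    comp-sound (c-letTensor p q) = sub-stoup-cong (comp-sound p) (c-lamc (comp-sound q))
    comp-sound (c-abort p) = sub-stoup-congˡ (comp-sound p) _
    comp-sound (c-inl p) = sub-stoup-congˡ (comp-sound p) _
    comp-sound (c-inr p) = sub-stoup-congˡ (comp-sound p) _
    comp-sound (c-case p q r) = sub-stoup-cong (comp-sound p) (c-pairc (comp-sound q) (comp-sound r))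
    comp-sound (c-apph p q) = sub-stoup-cong (comp-sound q) (c-apph (val-sound p) ≈-refl)
    comp-sound (η-𝟙c t) = ≈-sym (≈-≡ (η-𝟘 svar (comp t)) (sub-stoup-svar (comp t)))
    comp-sound (β-&₁ t u) = ≈-≡ (β-⊕₁ _ _ _) (sub-stoup-svar _)
    comp-sound (β-&₂ t u) = ≈-≡ (β-⊕₂ _ _ _) (sub-stoup-svar _)
    comp-sound (η-& t) = ≈-≡ (η-⊕ svar (comp t)) (sub-stoup-svar _)
    comp-sound (β-⇛ t u) = ≈-≡ (β-⊗ _ _ _) (trans (sub-stoup-svar _) (sym (comp-[] t u)))
    comp-sound (η-⇛ t) = ≡-≈ (cong (λ c → letTensor svar (sub-stoup c (tensor (var Z) svar))) (comp-wk t))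
                             (≈-≡ (η-⊗ svar (comp t)) (sub-stoup-svar _))
    comp-sound (η-𝕀 t u) = comp-plug u t (η-continuation-𝕀 u)
    comp-sound (η-! t u) = comp-plug u t (η-continuation-! u)
    comp-sound (β-⊗ t s u) = ≡-≈ (sub-stoup-assoc (comp s) _ _) (comp-plug (u [ t ]) s (≈-≡ (β-⇛ _ _) (sym (comp-[] u t))))
    comp-sound (η-⊗ t u) = comp-plug u t (η-continuation-⊗ u)
    comp-sound (η-𝟘 t u) = comp-plug u t (≈-sym (η-𝟙c _))
    comp-sound (β-⊕₁ t u u') = ≡-≈ (sub-stoup-assoc (comp t) _ _) (comp-plug u t (β-&₁ _ _))
    comp-sound (β-⊕₂ t u u') = ≡-≈ (sub-stoup-assoc (comp t) _ _) (comp-plug u' t (β-&₂ _ _))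
    comp-sound (η-⊕ t u) = comp-plug u t (η-continuation-⊕ u)
    comp-sound (β-⊸ t u) = comp-plug t u (≈-≡ (β-⊸ _ _) (sub-stoup-svar (comp t)))

theorem5p2 : (R : CTy) →
    (∀ {Γ A} {t u : Tm Γ nothing A} →
      t ≈ u → Translation.val R t ≈ Translation.val R u)
    × (∀ {Γ A B} {t u : Tm Γ (just A) ⌈ B ⌉} →
      t ≈ u → Translation.comp R t ≈ Translation.comp R u)
theorem5p2 R = val-sound , comp-sound
  where open Properties R
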